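{- Let $t$ be a term of $\Lambda_B$. If $\Gamma;\Delta\vdash t:A$ is derivable in $\mathbf{DLAL_B}$, then $t$ has a unique $\beta\delta$-normal form.
   Context: System $\mathbf{DLAL_B}$. Types: $A,B::=\alpha\mid A\multimap B\mid A\Rightarrow B\mid \S A\mid \forall\alpha.A\mid \mathbf{Bool}$. Terms of $\Lambda_B$: $t,u,v::=x\mid F\mid T\mid \lambda x.t\mid t\,u\mid \mathrm{if}\ t\ \mathrm{then}\ u\ \mathrm{else}\ v$. Besides $\beta$-reduction there is $\delta$-reduction, the contextual closure of $(\mathrm{if}\ T\ \mathrm{then}\ u\ \mathrm{else}\ v)\to u$ and $(\mathrm{if}\ F\ \mathrm{then}\ u\ \mathrm{else}\ v)\to v$; $\beta\delta$-reduction is their union. Judgements are $\Gamma;\Delta\vdash t:A$ where $\Gamma$ (non-linear) and $\Delta$ (linear) assign types to distinct variables, with disjoint domains. Rules: (Id) $;x:A\vdash x:A$. ($\multimap$i) from $\Gamma;\Delta,x:A\vdash t:B$ infer $\Gamma;\Delta\vdash\lambda x.t:A\multimap B$. ($\multimap$e) from $\Gamma_1;\Delta_1\vdash t:A\multimap B$ and $\Gamma_2;\Delta_2\vdash u:A$ infer $\Gamma_1,\Gamma_2;\Delta_1,\Delta_2\vdash t\,u:B$. ($\Rightarrow$i) from $\Gamma,x:A;\Delta\vdash t:B$ infer $\Gamma;\Delta\vdash \lambda x.t:A\Rightarrow B$. ($\Rightarrow$e) from $\Gamma;\Delta\vdash t:A\Rightarrow B$ and $;z:C\vdash u:A$ infer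 $\Gamma,z:C;\Delta\vdash t\,u:B$ (the right premise may also be $;\vdash u:A$, with conclusion $\Gamma;\Delta\vdash t\,u:B$). (Weak) from $\Gamma_1;\Delta_1\vdash t:A$ infer $\Gamma_1,\Gamma_2;\Delta_1,\Delta_2\vdash t:A$. (Cntr) from $x_1:A,x_2:A,\Gamma;\Delta\vdash t:B$ infer $x:A,\Gamma;\Delta\vdash t[x/x_1,x/x_2]:B$. ($\S$i) from $;\Gamma,\Delta\vdash t:A$ infer $\Gamma;\S\Delta\vdash t:\S A$ ($\S\Delta$ prefixes $\S$ to every type of $\Delta$). ($\S$e) from $\Gamma_1;\Delta_1\vdash u:\S A$ and $\Gamma_2;x:\S A,\Delta_2\vdash t:B$ infer $\Gamma_1,\Gamma_2;\Delta_1,\Delta_2\vdash t[u/x]:B$. ($\forall$i) from $\Gamma;\Delta\vdash t:A$ infer $\Gamma;\Delta\vdash t:\forall\alpha.A$ if $\alpha$ is not free in $\Gamma,\Delta$. ($\forall$e) from $\Gamma;\Delta\vdash t:\forall\alpha.A$ infer $\Gamma;\Delta\vdash t:A[B/\alpha]$. ($B_0$i) $;\vdash F:\mathbf{Bool}$; ($B_1$i) $;\vdash T:\mathbf{Bool}$. ($B$e) from $\Gamma;\Delta\vdash M_0:\S^k\mathbf{Bool}$ ($k\in\mathbb{N}$), $\Gamma;\Delta\vdash M_1:A$, $\Gamma;\Delta\vdash M_2:A$ infer $\Gamma;\Delta\vdash \mathrm{if}\ M_0\ \mathrm{then}\ M_1\ \mathrm{else}\ M_2:A$. -}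

module Defs where

open import Data.Nat using (ℕ; zero; suc; pred; _<ᵇ_; _≡ᵇ_)
open import Data.Bool using (if_then_else_)
open import Data.Fin using (Fin; zero; suc; _≟_)
open import Data.Vec using (Vec; []; _∷_; replicate; map; _[_]≔_; lookup)
open import Relation.Nullary using (¬_; does)
open import Relation.Binary.PropositionalEquality using (_≡_)
open import Relation.Binary.Construct.Closure.ReflexiveTransitive using (Star)

-- Types of DLAL_B.  Type variables are de Bruijn indices; ⋀ A is ∀α.A
-- with α bound as index 0.

infixr 20 _⊸_ _⇒_

data Ty : Set where
  tvar : ℕ → Ty
  _⊸_  : Ty → Ty → Ty
  _⇒_  : Ty → Ty → Ty
  §    : Ty → Ty
  ⋀    : Ty → Ty
  𝔹    : Ty

shiftTy : ℕ → Ty → Ty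
shiftTy c (tvar k) = if k <ᵇ c then tvar k else tvar (suc k)
shiftTy c (A ⊸ B)  = shiftTy c A ⊸ shiftTy c B
shiftTy c (A ⇒ B)  = shiftTy c A ⇒ shiftTy c B
shiftTy c (§ A)    = § (shiftTy c A)
shiftTy c (⋀ A)    = ⋀ (shiftTy (suc c) A)
shiftTy c 𝔹        = 𝔹

-- capture-avoiding substitution of B for variable j (variables above j
-- are decremented, since j is being eliminated)
substTy : ℕ → Ty → Ty → Ty
substTy j B (tvar k) = if k <ᵇ j then tvar k else
                       (if k ≡ᵇ j then B else tvar (pred k))
substTy j B (A ⊸ A') = substTy j B A ⊸ substTy j B A'
substTy j B (A ⇒ A') = substTy j B A ⇒ substTy j B A'
substTy j B (§ A)    = § (substTy j B A)
substTy j B (⋀ A)    = ⋀ (substTy (suc j) (shiftTy 0 B) A)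
substTy j B 𝔹        = 𝔹

-- A[B/α] where A is the body of ⋀ A
_[_]ᵀ : Ty → Ty → Ty
A [ B ]ᵀ = substTy 0 B A

§^ : ℕ → Ty → Ty
§^ zero    A = A
§^ (suc k) A = § (§^ k A)

-- Terms of Λ_B, well-scoped de Bruijn (n free variables).

data Tm (n : ℕ) : Set where
  var  : Fin n → Tm n
  Fl   : Tm n
  Tr   : Tm n
  lam  : Tm (suc n) → Tm n
  app  : Tm n → Tm n → Tm n
  ite  : Tm n → Tm n → Tm n → Tm n

ext : ∀ {n m} → (Fin n → Fin m) → Fin (suc n) → Fin (suc m)
ext ρ zero    = zero
ext ρ (suc k) = suc (ρ k)

rename : ∀ {n m} → (Fin n → Fin m) → Tm n → Tm m
rename ρ (var x)     = var (ρ x)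
rename ρ Fl          = Fl
rename ρ Tr          = Tr
rename ρ (lam t)     = lam (rename (ext ρ) t)
rename ρ (app t u)   = app (rename ρ t) (rename ρ u)
rename ρ (ite t u v) = ite (rename ρ t) (rename ρ u) (rename ρ v)

exts : ∀ {n m} → (Fin n → Tm m) → Fin (suc n) → Tm (suc m)
exts σ zero    = var zero
exts σ (suc k) = rename suc (σ k)

subst : ∀ {n m} → (Fin n → Tm m) → Tm n → Tm m
subst σ (var x)     = σ x
subst σ Fl          = Fl
subst σ Tr          = Tr
subst σ (lam t)     = lam (subst (exts σ) t)
subst σ (app t u)   = app (subst σ t) (subst σ u)
subst σ (ite t u v) = ite (subst σ t) (subst σ u) (subst σ v)

_[_] : ∀ {n} → Tm (suc n) → Tm n → Tm n
_[_] {n} t u = subst σ t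
  where
  σ : Fin (suc n) → Tm n
  σ zero    = u
  σ (suc k) = var k

-- renaming the variable j to i (used for contraction)
merge-var : ∀ {n} → Fin n → Fin n → Fin n → Fin n
merge-var j i k = if does (k ≟ j) then i else k

infix 4 _⟶_ _⟶*_

data _⟶_ {n : ℕ} : Tm n → Tm n → Set where
  β     : ∀ {t u} → app (lam t) u ⟶ t [ u ]
  δT    : ∀ {u v} → ite Tr u v ⟶ u
  δF    : ∀ {u v} → ite Fl u v ⟶ v
  ξlam  : ∀ {t t'} → t ⟶ t' → lam t ⟶ lam t'
  ξappl : ∀ {t t' u} → t ⟶ t' → app t u ⟶ app t' u
  ξappr : ∀ {t u u'} → u ⟶ u' → app t u ⟶ app t u'
  ξite₀ : ∀ {t t' u v} → t ⟶ t' → ite t u v ⟶ ite t' u v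
  ξite₁ : ∀ {t u u' v} → u ⟶ u' → ite t u v ⟶ ite t u' v
  ξite₂ : ∀ {t u v v'} → v ⟶ v' → ite t u v ⟶ ite t u v'

_⟶*_ : ∀ {n} → Tm n → Tm n → Set
_⟶*_ = Star _⟶_

Normal : ∀ {n} → Tm n → Set
Normal t = ∀ t' → ¬ (t ⟶ t')

-- Contexts Γ;Δ: each of the n variables in scope is either absent,
-- in the linear part Δ (lin A), or in the non-linear part Γ (nl A).

data Slot : Set where
  ∅   : Slot
  lin : Ty → Slot
  nl  : Ty → Slot

Ctx : ℕ → Set
Ctx n = Vec Slot n

empty : ∀ {n} → Ctx n
empty = replicate _ ∅

only : ∀ {n} → Fin n → Slot → Ctx n
only x s = empty [ x ]≔ s

shiftSlot : Slot → Slot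
shiftSlot ∅       = ∅
shiftSlot (lin A) = lin (shiftTy 0 A)
shiftSlot (nl A)  = nl (shiftTy 0 A)

-- Disjoint union of contexts (Γ₁,Γ₂ ; Δ₁,Δ₂)
data MergeS : Slot → Slot → Slot → Set where
  left  : ∀ {s} → MergeS s ∅ s
  right : ∀ {s} → MergeS ∅ s s

data Merge : ∀ {n} → Ctx n → Ctx n → Ctx n → Set where
  []  : Merge [] [] []
  _∷_ : ∀ {n s₁ s₂ s} {C₁ C₂ C : Ctx n} →
        MergeS s₁ s₂ s → Merge C₁ C₂ C → Merge (s₁ ∷ C₁) (s₂ ∷ C₂) (s ∷ C)

-- Extension of a context by further variables (weakening)
data SubS : Slot → Slot → Set where
  absent : ∀ {s} → SubS ∅ s
  same   : ∀ {s} → SubS s s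

data Sub : ∀ {n} → Ctx n → Ctx n → Set where
  []  : Sub [] []
  _∷_ : ∀ {n s s'} {C C' : Ctx n} → SubS s s' → Sub C C' → Sub (s ∷ C) (s' ∷ C')

-- Relation between the premise ;Γ,Δ and the conclusion Γ;§Δ of (§i)
data ParS : Slot → Slot → Set where
  none  : ParS ∅ ∅
  toΓ   : ∀ {A} → ParS (lin A) (nl A)
  toΔ   : ∀ {A} → ParS (lin A) (lin (§ A))

data Par : ∀ {n} → Ctx n → Ctx n → Set where
  []  : Par [] []
  _∷_ : ∀ {n s s'} {C C' : Ctx n} → ParS s s' → Par C C' → Par (s ∷ C) (s' ∷ C')

infix 3 _⊢_∶_

data _⊢_∶_ {n : ℕ} : Ctx n → Tm n → Ty → Set where
  Id   : ∀ {x A} → only x (lin A) ⊢ var x ∶ A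
  ⊸i   : ∀ {C t A B} → lin A ∷ C ⊢ t ∶ B → C ⊢ lam t ∶ A ⊸ B
  ⊸e   : ∀ {C₁ C₂ C t u A B} → C₁ ⊢ t ∶ A ⊸ B → C₂ ⊢ u ∶ A →
         Merge C₁ C₂ C → C ⊢ app t u ∶ B
  ⇒i   : ∀ {C t A B} → nl A ∷ C ⊢ t ∶ B → C ⊢ lam t ∶ A ⇒ B
  -- right premise ;z:A' ⊢ u : A
  ⇒e₁  : ∀ {C C' t u A B z A'} → C ⊢ t ∶ A ⇒ B → only z (lin A') ⊢ u ∶ A →
         Merge C (only z (nl A')) C' → C' ⊢ app t u ∶ B
  -- right premise ; ⊢ u : A
  ⇒e₀  : ∀ {C t u A B} → C ⊢ t ∶ A ⇒ B → empty ⊢ u ∶ A → C ⊢ app t u ∶ B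
  Weak : ∀ {C C' t A} → C ⊢ t ∶ A → Sub C C' → C' ⊢ t ∶ A
  Cntr : ∀ {C t A B} (x₁ x₂ : Fin n) → ¬ (x₁ ≡ x₂) →
         lookup C x₁ ≡ nl A → lookup C x₂ ≡ nl A → C ⊢ t ∶ B →
         C [ x₂ ]≔ ∅ ⊢ rename (merge-var x₂ x₁) t ∶ B
  §i   : ∀ {C C' t A} → C ⊢ t ∶ A → Par C C' → C' ⊢ t ∶ § A
  §e   : ∀ {C₁ C₂ C u t A B} → C₁ ⊢ u ∶ § A → lin (§ A) ∷ C₂ ⊢ t ∶ B →
         Merge C₁ C₂ C → C ⊢ t [ u ] ∶ B
  ∀i   : ∀ {C t A} → map shiftSlot C ⊢ t ∶ A → C ⊢ t ∶ ⋀ A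
  ∀e   : ∀ {C t A} B → C ⊢ t ∶ ⋀ A → C ⊢ t ∶ A [ B ]ᵀ
  B₀i  : empty ⊢ Fl ∶ 𝔹
  B₁i  : empty ⊢ Tr ∶ 𝔹
  Be   : ∀ {C M₀ M₁ M₂ A} k → C ⊢ M₀ ∶ §^ k 𝔹 → C ⊢ M₁ ∶ A → C ⊢ M₂ ∶ A →
         C ⊢ ite M₀ M₁ M₂ ∶ A

module Submission where

-- Uniqueness: βδ-reduction is confluent (parallel reduction and Takahashi's
-- complete development), so a term has at most one normal form.
-- Existence: a derivation is translated into an annotated term recording its
-- proof structure — linear vs. non-linear abstractions and applications, and
-- §-boxes whose doors are the §-typed terms substituted by (§e).  Annotated
-- terms have a typing discipline with a depth budget L that is preserved by
-- reduction, and a weight at each depth d ≤ L.  Linearity (linear variables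
-- occur at most once, non-linear ones never at depth 0) makes every step
-- decrease the weight vector lexicographically, so annotated terms normalise
-- by well-founded induction, and erasure maps annotated steps to βδ-steps.

open import Defs
open import Data.Bool using (true; false; if_then_else_)
open import Data.Empty using (⊥; ⊥-elim)
open import Data.Fin using (Fin; zero; suc)
import Data.Fin.Properties as Fin
open import Data.Nat using (ℕ; zero; suc; pred; _+_; _*_; _⊔_; _≤_; _<_; z≤n; s≤s; _<ᵇ_; _≡ᵇ_; >-nonZero)
open import Data.Nat.Induction using (<-wellFounded)
open import Data.Nat.Properties
open import Algebra.Properties.CommutativeSemigroup +-commutativeSemigroup using (interchange)
open import Data.Product using (Σ; ∃; ∃!; _×_; _,_; proj₁; proj₂)
open import Data.Sum using (_⊎_; inj₁; inj₂)
open import Data.Unit using (⊤; tt)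
open import Data.Vec using (Vec; []; _∷_; lookup; map; replicate; _[_]≔_; allFin)
import Data.Vec as Vec
open import Data.Vec.Membership.Propositional using (_∈_)
open import Data.Vec.Membership.Propositional.Properties using (∈-map⁺; ∈-allFin⁺)
open import Data.Vec.Relation.Unary.Any using (here; there)
open import Data.Vec.Properties using (lookup-map; lookup∘update; lookup∘update′; lookup-replicate)
open import Induction.WellFounded using (Acc; acc; WellFounded)
open import Relation.Binary using (tri<; tri≈; tri>)
open import Relation.Binary.Construct.Closure.ReflexiveTransitive using (Star; ε; _◅_; _◅◅_)
open import Relation.Binary.PropositionalEquality
  using (_≡_; refl; sym; trans; cong; cong₂; subst₂; module ≡-Reasoning)
  renaming (subst to transport)
open import Relation.Nullary using (¬_; Dec; yes; no)
open import Relation.Nullary.Decidable using (dec-true; dec-false)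

cong₃ : ∀ {A B C D : Set} (f : A → B → C → D) {a a' b b' c c'} →
        a ≡ a' → b ≡ b' → c ≡ c' → f a b c ≡ f a' b' c'
cong₃ f refl refl refl = refl

ext-cong : ∀ {n m} {ρ ρ' : Fin n → Fin m} → (∀ x → ρ x ≡ ρ' x) → ∀ x → ext ρ x ≡ ext ρ' x
ext-cong h zero    = refl
ext-cong h (suc x) = cong suc (h x)

rename-cong : ∀ {n m} {ρ ρ' : Fin n → Fin m} → (∀ x → ρ x ≡ ρ' x) → ∀ t → rename ρ t ≡ rename ρ' t
rename-cong h (var x)     = cong var (h x)
rename-cong h Fl          = refl
rename-cong h Tr          = refl
rename-cong h (lam t)     = cong lam (rename-cong (ext-cong h) t)
rename-cong h (app t u)   = cong₂ app (rename-cong h t) (rename-cong h u)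
rename-cong h (ite t u v) = cong₃ ite (rename-cong h t) (rename-cong h u) (rename-cong h v)

exts-cong : ∀ {n m} {σ σ' : Fin n → Tm m} → (∀ x → σ x ≡ σ' x) → ∀ x → exts σ x ≡ exts σ' x
exts-cong h zero    = refl
exts-cong h (suc x) = cong (rename suc) (h x)

subst-cong : ∀ {n m} {σ σ' : Fin n → Tm m} → (∀ x → σ x ≡ σ' x) → ∀ t → subst σ t ≡ subst σ' t
subst-cong h (var x)     = h x
subst-cong h Fl          = refl
subst-cong h Tr          = refl
subst-cong h (lam t)     = cong lam (subst-cong (exts-cong h) t)
subst-cong h (app t u)   = cong₂ app (subst-cong h t) (subst-cong h u)
subst-cong h (ite t u v) = cong₃ ite (subst-cong h t) (subst-cong h u) (subst-cong h v)

rename-rename : ∀ {n m k} (ρ : Fin m → Fin k) (ρ' : Fin n → Fin m) t →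
                rename ρ (rename ρ' t) ≡ rename (λ x → ρ (ρ' x)) t
rename-rename ρ ρ' (var x)     = refl
rename-rename ρ ρ' Fl          = refl
rename-rename ρ ρ' Tr          = refl
rename-rename ρ ρ' (lam t)     =
  cong lam (trans (rename-rename (ext ρ) (ext ρ') t) (rename-cong (λ { zero → refl ; (suc x) → refl }) t))
rename-rename ρ ρ' (app t u)   = cong₂ app (rename-rename ρ ρ' t) (rename-rename ρ ρ' u)
rename-rename ρ ρ' (ite t u v) = cong₃ ite (rename-rename ρ ρ' t) (rename-rename ρ ρ' u) (rename-rename ρ ρ' v)

subst-rename : ∀ {n m k} (σ : Fin m → Tm k) (ρ : Fin n → Fin m) t →
               subst σ (rename ρ t) ≡ subst (λ x → σ (ρ x)) t
subst-rename σ ρ (var x)     = refl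
subst-rename σ ρ Fl          = refl
subst-rename σ ρ Tr          = refl
subst-rename σ ρ (lam t)     =
  cong lam (trans (subst-rename (exts σ) (ext ρ) t) (subst-cong (λ { zero → refl ; (suc x) → refl }) t))
subst-rename σ ρ (app t u)   = cong₂ app (subst-rename σ ρ t) (subst-rename σ ρ u)
subst-rename σ ρ (ite t u v) = cong₃ ite (subst-rename σ ρ t) (subst-rename σ ρ u) (subst-rename σ ρ v)

rename-subst : ∀ {n m k} (ρ : Fin m → Fin k) (σ : Fin n → Tm m) t →
               rename ρ (subst σ t) ≡ subst (λ x → rename ρ (σ x)) t
rename-subst ρ σ (var x)     = refl
rename-subst ρ σ Fl          = refl
rename-subst ρ σ Tr          = refl
rename-subst ρ σ (lam t)     = cong lam (trans (rename-subst (ext ρ) (exts σ) t) (subst-cong commute t))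
  where
  commute : ∀ x → rename (ext ρ) (exts σ x) ≡ exts (λ x → rename ρ (σ x)) x
  commute zero    = refl
  commute (suc x) = trans (rename-rename (ext ρ) suc (σ x)) (sym (rename-rename suc ρ (σ x)))
rename-subst ρ σ (app t u)   = cong₂ app (rename-subst ρ σ t) (rename-subst ρ σ u)
rename-subst ρ σ (ite t u v) = cong₃ ite (rename-subst ρ σ t) (rename-subst ρ σ u) (rename-subst ρ σ v)

subst-subst : ∀ {n m k} (σ : Fin m → Tm k) (τ : Fin n → Tm m) t →
              subst σ (subst τ t) ≡ subst (λ x → subst σ (τ x)) t
subst-subst σ τ (var x)     = refl
subst-subst σ τ Fl          = refl
subst-subst σ τ Tr          = refl
subst-subst σ τ (lam t)     = cong lam (trans (subst-subst (exts σ) (exts τ) t) (subst-cong commute t))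
  where
  commute : ∀ x → subst (exts σ) (exts τ x) ≡ exts (λ x → subst σ (τ x)) x
  commute zero    = refl
  commute (suc x) = trans (subst-rename (exts σ) suc (τ x)) (sym (rename-subst suc σ (τ x)))
subst-subst σ τ (app t u)   = cong₂ app (subst-subst σ τ t) (subst-subst σ τ u)
subst-subst σ τ (ite t u v) = cong₃ ite (subst-subst σ τ t) (subst-subst σ τ u) (subst-subst σ τ v)

subst-var : ∀ {n} (t : Tm n) → subst var t ≡ t
subst-var (var x)     = refl
subst-var Fl          = refl
subst-var Tr          = refl
subst-var (lam t)     = cong lam (trans (subst-cong (λ { zero → refl ; (suc x) → refl }) t) (subst-var t))
subst-var (app t u)   = cong₂ app (subst-var t) (subst-var u)
subst-var (ite t u v) = cong₃ ite (subst-var t) (subst-var u) (subst-var v)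

rename-as-subst : ∀ {n m} (ρ : Fin n → Fin m) t → rename ρ t ≡ subst (λ x → var (ρ x)) t
rename-as-subst ρ t = trans (sym (subst-var (rename ρ t))) (subst-rename var ρ t)

single : ∀ {n} → Tm n → Fin (suc n) → Tm n
single u zero    = u
single u (suc x) = var x

[]-as-subst : ∀ {n} (t : Tm (suc n)) u → t [ u ] ≡ subst (single u) t
[]-as-subst t u = subst-cong (λ { zero → refl ; (suc x) → refl }) t

subst-[] : ∀ {n m} (σ : Fin n → Tm m) t u → subst σ (t [ u ]) ≡ (subst (exts σ) t) [ subst σ u ]
subst-[] σ t u = begin
    subst σ (t [ u ])                                       ≡⟨ cong (subst σ) ([]-as-subst t u) ⟩
    subst σ (subst (single u) t)                             ≡⟨ subst-subst σ (single u) t ⟩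
    subst (λ x → subst σ (single u x)) t                     ≡⟨ subst-cong commute t ⟩
    subst (λ x → subst (single (subst σ u)) (exts σ x)) t    ≡⟨ sym (subst-subst (single (subst σ u)) (exts σ) t) ⟩
    subst (single (subst σ u)) (subst (exts σ) t)            ≡⟨ sym ([]-as-subst (subst (exts σ) t) (subst σ u)) ⟩
    (subst (exts σ) t) [ subst σ u ]                         ∎
  where
  open ≡-Reasoning
  commute : ∀ x → subst σ (single u x) ≡ subst (single (subst σ u)) (exts σ x)
  commute zero    = refl
  commute (suc x) = sym (trans (subst-rename (single (subst σ u)) suc (σ x)) (subst-var (σ x)))

rename-[] : ∀ {n m} (ρ : Fin n → Fin m) t u → rename ρ (t [ u ]) ≡ (rename (ext ρ) t) [ rename ρ u ]
rename-[] ρ t u = begin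
    rename ρ (t [ u ])                                               ≡⟨ rename-as-subst ρ _ ⟩
    subst (λ x → var (ρ x)) (t [ u ])                                 ≡⟨ subst-[] _ t u ⟩
    (subst (exts (λ x → var (ρ x))) t) [ subst (λ x → var (ρ x)) u ]  ≡⟨ cong₂ _[_] body (sym (rename-as-subst ρ u)) ⟩
    (rename (ext ρ) t) [ rename ρ u ]                                 ∎
  where
  open ≡-Reasoning
  body : subst (exts (λ x → var (ρ x))) t ≡ rename (ext ρ) t
  body = trans (subst-cong (λ { zero → refl ; (suc x) → refl }) t) (sym (rename-as-subst (ext ρ) t))

rename-⟶ : ∀ {n m} (ρ : Fin n → Fin m) {t t'} → t ⟶ t' → rename ρ t ⟶ rename ρ t'
rename-⟶ ρ (β {t} {u})  = transport (app (lam (rename (ext ρ) t)) (rename ρ u) ⟶_) (sym (rename-[] ρ t u)) β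
rename-⟶ ρ δT           = δT
rename-⟶ ρ δF           = δF
rename-⟶ ρ (ξlam s)     = ξlam (rename-⟶ (ext ρ) s)
rename-⟶ ρ (ξappl s)    = ξappl (rename-⟶ ρ s)
rename-⟶ ρ (ξappr s)    = ξappr (rename-⟶ ρ s)
rename-⟶ ρ (ξite₀ s)    = ξite₀ (rename-⟶ ρ s)
rename-⟶ ρ (ξite₁ s)    = ξite₁ (rename-⟶ ρ s)
rename-⟶ ρ (ξite₂ s)    = ξite₂ (rename-⟶ ρ s)

subst-⟶ : ∀ {n m} (σ : Fin n → Tm m) {t t'} → t ⟶ t' → subst σ t ⟶ subst σ t'
subst-⟶ σ (β {t} {u})  = transport (app (lam (subst (exts σ) t)) (subst σ u) ⟶_) (sym (subst-[] σ t u)) β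
subst-⟶ σ δT           = δT
subst-⟶ σ δF           = δF
subst-⟶ σ (ξlam s)     = ξlam (subst-⟶ (exts σ) s)
subst-⟶ σ (ξappl s)    = ξappl (subst-⟶ σ s)
subst-⟶ σ (ξappr s)    = ξappr (subst-⟶ σ s)
subst-⟶ σ (ξite₀ s)    = ξite₀ (subst-⟶ σ s)
subst-⟶ σ (ξite₁ s)    = ξite₁ (subst-⟶ σ s)
subst-⟶ σ (ξite₂ s)    = ξite₂ (subst-⟶ σ s)

map-⟶* : ∀ {n m} (f : Tm n → Tm m) → (∀ {t t'} → t ⟶ t' → f t ⟶ f t') → ∀ {t t'} → t ⟶* t' → f t ⟶* f t'
map-⟶* f h ε        = ε
map-⟶* f h (s ◅ ss) = h s ◅ map-⟶* f h ss

lam* : ∀ {n} {t t' : Tm (suc n)} → t ⟶* t' → lam t ⟶* lam t'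
lam* = map-⟶* lam ξlam

app* : ∀ {n} {t t' u u' : Tm n} → t ⟶* t' → u ⟶* u' → app t u ⟶* app t' u'
app* {t' = t'} {u = u} s₁ s₂ = map-⟶* (λ z → app z u) ξappl s₁ ◅◅ map-⟶* (app t') ξappr s₂

ite* : ∀ {n} {c c' a a' b b' : Tm n} → c ⟶* c' → a ⟶* a' → b ⟶* b' → ite c a b ⟶* ite c' a' b'
ite* {c' = c'} {a = a} {a' = a'} {b = b} s₁ s₂ s₃ =
  map-⟶* (λ z → ite z a b) ξite₀ s₁ ◅◅ map-⟶* (λ z → ite c' z b) ξite₁ s₂ ◅◅ map-⟶* (ite c' a') ξite₂ s₃

subst-⟶*-pointwise : ∀ {n m} {σ σ' : Fin n → Tm m} → (∀ x → σ x ⟶* σ' x) → ∀ t → subst σ t ⟶* subst σ' t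
subst-⟶*-pointwise h (var x)     = h x
subst-⟶*-pointwise h Fl          = ε
subst-⟶*-pointwise h Tr          = ε
subst-⟶*-pointwise h (lam t)     =
  lam* (subst-⟶*-pointwise (λ { zero → ε ; (suc x) → map-⟶* (rename suc) (rename-⟶ suc) (h x) }) t)
subst-⟶*-pointwise h (app t u)   = app* (subst-⟶*-pointwise h t) (subst-⟶*-pointwise h u)
subst-⟶*-pointwise h (ite t u v) = ite* (subst-⟶*-pointwise h t) (subst-⟶*-pointwise h u) (subst-⟶*-pointwise h v)

[]-⟶*ˡ : ∀ {n} {t t' : Tm (suc n)} (u : Tm n) → t ⟶* t' → t [ u ] ⟶* t' [ u ]
[]-⟶*ˡ {t = t} {t'} u s =
  subst₂ _⟶*_ (sym ([]-as-subst t u)) (sym ([]-as-subst t' u)) (map-⟶* (subst (single u)) (subst-⟶ (single u)) s)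

[]-⟶*ʳ : ∀ {n} (t : Tm (suc n)) {u u' : Tm n} → u ⟶* u' → t [ u ] ⟶* t [ u' ]
[]-⟶*ʳ t {u} {u'} s =
  subst₂ _⟶*_ (sym ([]-as-subst t u)) (sym ([]-as-subst t u'))
         (subst-⟶*-pointwise (λ { zero → s ; (suc x) → ε }) t)

NotLam : ∀ {n} → Tm n → Set
NotLam (lam _) = ⊥
NotLam _       = ⊤

NotBool : ∀ {n} → Tm n → Set
NotBool Tr = ⊥
NotBool Fl = ⊥
NotBool _  = ⊤

data Nf {n : ℕ} : Tm n → Set where
  nvar : ∀ {x} → Nf (var x)
  nF   : Nf Fl
  nT   : Nf Tr
  nlam : ∀ {t} → Nf t → Nf (lam t)
  napp : ∀ {t u} → Nf t → Nf u → NotLam t → Nf (app t u)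
  nite : ∀ {c a b} → Nf c → Nf a → Nf b → NotBool c → Nf (ite c a b)

Nf⇒Normal : ∀ {n} {t : Tm n} → Nf t → Normal t
Nf⇒Normal nvar               _ ()
Nf⇒Normal nF                 _ ()
Nf⇒Normal nT                 _ ()
Nf⇒Normal (nlam h)           _ (ξlam s)  = Nf⇒Normal h _ s
Nf⇒Normal (napp h₁ h₂ ¬lam)  _ β         = ¬lam
Nf⇒Normal (napp h₁ h₂ ¬lam)  _ (ξappl s) = Nf⇒Normal h₁ _ s
Nf⇒Normal (napp h₁ h₂ ¬lam)  _ (ξappr s) = Nf⇒Normal h₂ _ s
Nf⇒Normal (nite h₀ h₁ h₂ ¬b) _ δT        = ¬b
Nf⇒Normal (nite h₀ h₁ h₂ ¬b) _ δF        = ¬b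
Nf⇒Normal (nite h₀ h₁ h₂ ¬b) _ (ξite₀ s) = Nf⇒Normal h₀ _ s
Nf⇒Normal (nite h₀ h₁ h₂ ¬b) _ (ξite₁ s) = Nf⇒Normal h₁ _ s
Nf⇒Normal (nite h₀ h₁ h₂ ¬b) _ (ξite₂ s) = Nf⇒Normal h₂ _ s

-- Normal terms that create no redex wherever they are substituted.
Inert : ∀ {n} → Tm n → Set
Inert t = Nf t × NotLam t × NotBool t

var-inert : ∀ {n} (x : Fin n) → Inert (var x)
var-inert x = nvar , tt , tt

rename-NotLam : ∀ {n m} (ρ : Fin n → Fin m) t → NotLam t → NotLam (rename ρ t)
rename-NotLam ρ (var x)     h = tt
rename-NotLam ρ Fl          h = tt
rename-NotLam ρ Tr          h = tt
rename-NotLam ρ (app t u)   h = tt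
rename-NotLam ρ (ite t u v) h = tt

rename-NotBool : ∀ {n m} (ρ : Fin n → Fin m) t → NotBool t → NotBool (rename ρ t)
rename-NotBool ρ (var x)     h = tt
rename-NotBool ρ (lam t)     h = tt
rename-NotBool ρ (app t u)   h = tt
rename-NotBool ρ (ite t u v) h = tt

rename-Nf : ∀ {n m} (ρ : Fin n → Fin m) {t} → Nf t → Nf (rename ρ t)
rename-Nf ρ nvar                  = nvar
rename-Nf ρ nF                    = nF
rename-Nf ρ nT                    = nT
rename-Nf ρ (nlam h)              = nlam (rename-Nf (ext ρ) h)
rename-Nf ρ (napp {t} h₁ h₂ ¬lam) = napp (rename-Nf ρ h₁) (rename-Nf ρ h₂) (rename-NotLam ρ t ¬lam)
rename-Nf ρ (nite {c} h₀ h₁ h₂ ¬b) =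
  nite (rename-Nf ρ h₀) (rename-Nf ρ h₁) (rename-Nf ρ h₂) (rename-NotBool ρ c ¬b)

rename-Inert : ∀ {n m} (ρ : Fin n → Fin m) {t} → Inert t → Inert (rename ρ t)
rename-Inert ρ {t} (h , ¬lam , ¬b) = rename-Nf ρ h , rename-NotLam ρ t ¬lam , rename-NotBool ρ t ¬b

subst-Nf : ∀ {n m} (σ : Fin n → Tm m) → (∀ x → Inert (σ x)) → ∀ {t} → Nf t → Nf (subst σ t)
subst-Nf σ h nvar        = proj₁ (h _)
subst-Nf σ h nF          = nF
subst-Nf σ h nT          = nT
subst-Nf σ h (nlam n₁)   = nlam (subst-Nf (exts σ) h↑ n₁)
  where
  h↑ : ∀ x → Inert (exts σ x)
  h↑ zero    = var-inert zero
  h↑ (suc x) = rename-Inert suc (h x)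
subst-Nf σ h (napp {t} n₁ n₂ ¬lam) = napp (subst-Nf σ h n₁) (subst-Nf σ h n₂) (notLam t ¬lam)
  where
  notLam : ∀ t → NotLam t → NotLam (subst σ t)
  notLam (var x)     _ = proj₁ (proj₂ (h x))
  notLam Fl          _ = tt
  notLam Tr          _ = tt
  notLam (app _ _)   _ = tt
  notLam (ite _ _ _) _ = tt
subst-Nf σ h (nite {c} n₀ n₁ n₂ ¬b) = nite (subst-Nf σ h n₀) (subst-Nf σ h n₁) (subst-Nf σ h n₂) (notBool c ¬b)
  where
  notBool : ∀ t → NotBool t → NotBool (subst σ t)
  notBool (var x)     _ = proj₂ (proj₂ (h x))
  notBool (lam _)     _ = tt
  notBool (app _ _)   _ = tt
  notBool (ite _ _ _) _ = tt

[]-Nf : ∀ {n} {t : Tm (suc n)} {u : Tm n} → Nf t → Inert u → Nf (t [ u ])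
[]-Nf {t = t} {u} nt iu =
  transport Nf (sym ([]-as-subst t u)) (subst-Nf (single u) (λ { zero → iu ; (suc x) → var-inert x }) nt)

-- Confluence via parallel reduction; hence normal forms are unique.

infix 4 _⇛_ _⇛*_

data _⇛_ {n : ℕ} : Tm n → Tm n → Set where
  pvar  : ∀ {x} → var x ⇛ var x
  pF    : Fl ⇛ Fl
  pT    : Tr ⇛ Tr
  plam  : ∀ {t t'} → t ⇛ t' → lam t ⇛ lam t'
  papp  : ∀ {t t' u u'} → t ⇛ t' → u ⇛ u' → app t u ⇛ app t' u'
  pβ    : ∀ {t t' u u'} → t ⇛ t' → u ⇛ u' → app (lam t) u ⇛ t' [ u' ]
  pite  : ∀ {c c' a a' b b'} → c ⇛ c' → a ⇛ a' → b ⇛ b' → ite c a b ⇛ ite c' a' b'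
  pδT   : ∀ {a a' b} → a ⇛ a' → ite Tr a b ⇛ a'
  pδF   : ∀ {a b b'} → b ⇛ b' → ite Fl a b ⇛ b'

_⇛*_ : ∀ {n} → Tm n → Tm n → Set
_⇛*_ = Star _⇛_

⇛-refl : ∀ {n} (t : Tm n) → t ⇛ t
⇛-refl (var x)     = pvar
⇛-refl Fl          = pF
⇛-refl Tr          = pT
⇛-refl (lam t)     = plam (⇛-refl t)
⇛-refl (app t u)   = papp (⇛-refl t) (⇛-refl u)
⇛-refl (ite c a b) = pite (⇛-refl c) (⇛-refl a) (⇛-refl b)

⟶⇒⇛ : ∀ {n} {t t' : Tm n} → t ⟶ t' → t ⇛ t'
⟶⇒⇛ (β {t} {u})             = pβ (⇛-refl t) (⇛-refl u)
⟶⇒⇛ (δT {u})                = pδT (⇛-refl u)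
⟶⇒⇛ (δF {v = v})            = pδF (⇛-refl v)
⟶⇒⇛ (ξlam s)                = plam (⟶⇒⇛ s)
⟶⇒⇛ (ξappl {u = u} s)       = papp (⟶⇒⇛ s) (⇛-refl u)
⟶⇒⇛ (ξappr {t = t} s)       = papp (⇛-refl t) (⟶⇒⇛ s)
⟶⇒⇛ (ξite₀ {u = u} {v} s)   = pite (⟶⇒⇛ s) (⇛-refl u) (⇛-refl v)
⟶⇒⇛ (ξite₁ {t = t} {v = v} s) = pite (⇛-refl t) (⟶⇒⇛ s) (⇛-refl v)
⟶⇒⇛ (ξite₂ {t = t} {u} s)   = pite (⇛-refl t) (⇛-refl u) (⟶⇒⇛ s)

⇛⇒⟶* : ∀ {n} {t t' : Tm n} → t ⇛ t' → t ⟶* t'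
⇛⇒⟶* pvar         = ε
⇛⇒⟶* pF           = ε
⇛⇒⟶* pT           = ε
⇛⇒⟶* (plam p)     = lam* (⇛⇒⟶* p)
⇛⇒⟶* (papp p q)   = app* (⇛⇒⟶* p) (⇛⇒⟶* q)
⇛⇒⟶* (pβ p q)     = app* (lam* (⇛⇒⟶* p)) (⇛⇒⟶* q) ◅◅ (β ◅ ε)
⇛⇒⟶* (pite p q r) = ite* (⇛⇒⟶* p) (⇛⇒⟶* q) (⇛⇒⟶* r)
⇛⇒⟶* (pδT p)      = δT ◅ ⇛⇒⟶* p
⇛⇒⟶* (pδF p)      = δF ◅ ⇛⇒⟶* p

⇛-rename : ∀ {n m} (ρ : Fin n → Fin m) {t t'} → t ⇛ t' → rename ρ t ⇛ rename ρ t'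
⇛-rename ρ pvar         = pvar
⇛-rename ρ pF           = pF
⇛-rename ρ pT           = pT
⇛-rename ρ (plam p)     = plam (⇛-rename (ext ρ) p)
⇛-rename ρ (papp p q)   = papp (⇛-rename ρ p) (⇛-rename ρ q)
⇛-rename ρ (pβ {t} {t'} {u} {u'} p q) =
  transport (app (lam (rename (ext ρ) t)) (rename ρ u) ⇛_) (sym (rename-[] ρ t' u'))
            (pβ (⇛-rename (ext ρ) p) (⇛-rename ρ q))
⇛-rename ρ (pite p q r) = pite (⇛-rename ρ p) (⇛-rename ρ q) (⇛-rename ρ r)
⇛-rename ρ (pδT p)      = pδT (⇛-rename ρ p)
⇛-rename ρ (pδF p)      = pδF (⇛-rename ρ p)

⇛-exts : ∀ {n m} {σ σ' : Fin n → Tm m} → (∀ x → σ x ⇛ σ' x) → ∀ x → exts σ x ⇛ exts σ' x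
⇛-exts h zero    = pvar
⇛-exts h (suc x) = ⇛-rename suc (h x)

⇛-subst : ∀ {n m} {σ σ' : Fin n → Tm m} → (∀ x → σ x ⇛ σ' x) → ∀ {t t'} → t ⇛ t' → subst σ t ⇛ subst σ' t'
⇛-subst h pvar         = h _
⇛-subst h pF           = pF
⇛-subst h pT           = pT
⇛-subst h (plam p)     = plam (⇛-subst (⇛-exts h) p)
⇛-subst h (papp p q)   = papp (⇛-subst h p) (⇛-subst h q)
⇛-subst {σ = σ} {σ'} h (pβ {t} {t'} {u} {u'} p q) =
  transport (app (lam (subst (exts σ) t)) (subst σ u) ⇛_) (sym (subst-[] σ' t' u'))
            (pβ (⇛-subst (⇛-exts h) p) (⇛-subst h q))
⇛-subst h (pite p q r) = pite (⇛-subst h p) (⇛-subst h q) (⇛-subst h r)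
⇛-subst h (pδT p)      = pδT (⇛-subst h p)
⇛-subst h (pδF p)      = pδF (⇛-subst h p)

⇛-[] : ∀ {n} {t t' : Tm (suc n)} {u u'} → t ⇛ t' → u ⇛ u' → t [ u ] ⇛ t' [ u' ]
⇛-[] {t = t} {t'} {u} {u'} p q =
  subst₂ _⇛_ (sym ([]-as-subst t u)) (sym ([]-as-subst t' u')) (⇛-subst (λ { zero → q ; (suc x) → pvar }) p)

-- Takahashi's complete development: contract every redex of the term.
develop : ∀ {n} → Tm n → Tm n
develop (var x)         = var x
develop Fl              = Fl
develop Tr              = Tr
develop (lam t)         = lam (develop t)
develop (app (lam t) u) = develop t [ develop u ]
develop (app t u)       = app (develop t) (develop u)
develop (ite Tr a b)    = develop a
develop (ite Fl a b)    = develop b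
develop (ite c a b)     = ite (develop c) (develop a) (develop b)

triangle : ∀ {n} {t t' : Tm n} → t ⇛ t' → t' ⇛ develop t
triangle pvar                      = pvar
triangle pF                        = pF
triangle pT                        = pT
triangle (plam p)                  = plam (triangle p)
triangle (papp pvar q)             = papp pvar (triangle q)
triangle (papp pF q)               = papp pF (triangle q)
triangle (papp pT q)               = papp pT (triangle q)
triangle (papp (plam p) q)         = pβ (triangle p) (triangle q)
triangle (papp p@(papp _ _) q)     = papp (triangle p) (triangle q)
triangle (papp p@(pβ _ _) q)       = papp (triangle p) (triangle q)
triangle (papp p@(pite _ _ _) q)   = papp (triangle p) (triangle q)
triangle (papp p@(pδT _) q)        = papp (triangle p) (triangle q)
triangle (papp p@(pδF _) q)        = papp (triangle p) (triangle q)
triangle (pβ p q)                  = ⇛-[] (triangle p) (triangle q)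
triangle (pite pT q r)             = pδT (triangle q)
triangle (pite pF q r)             = pδF (triangle r)
triangle (pite p@pvar q r)         = pite (triangle p) (triangle q) (triangle r)
triangle (pite p@(plam _) q r)     = pite (triangle p) (triangle q) (triangle r)
triangle (pite p@(papp _ _) q r)   = pite (triangle p) (triangle q) (triangle r)
triangle (pite p@(pβ _ _) q r)     = pite (triangle p) (triangle q) (triangle r)
triangle (pite p@(pite _ _ _) q r) = pite (triangle p) (triangle q) (triangle r)
triangle (pite p@(pδT _) q r)      = pite (triangle p) (triangle q) (triangle r)
triangle (pite p@(pδF _) q r)      = pite (triangle p) (triangle q) (triangle r)
triangle (pδT p)                   = triangle p
triangle (pδF p)                   = triangle p

strip : ∀ {n} {t u₁ u₂ : Tm n} → t ⇛ u₁ → t ⇛* u₂ → ∃ λ w → (u₁ ⇛* w) × (u₂ ⇛ w)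
strip {u₁ = u₁} p ε = u₁ , ε , p
strip p (q ◅ qs) with strip (triangle q) qs
... | w , s , r = w , (triangle p ◅ s) , r

⇛*-confluent : ∀ {n} {t u₁ u₂ : Tm n} → t ⇛* u₁ → t ⇛* u₂ → ∃ λ w → (u₁ ⇛* w) × (u₂ ⇛* w)
⇛*-confluent {u₂ = u₂} ε qs = u₂ , qs , ε
⇛*-confluent (p ◅ ps) qs with strip p qs
... | w , s , r with ⇛*-confluent ps s
...   | w' , s₁ , s₂ = w' , s₁ , (r ◅ s₂)

⟶*⇒⇛* : ∀ {n} {t t' : Tm n} → t ⟶* t' → t ⇛* t'
⟶*⇒⇛* ε        = ε
⟶*⇒⇛* (s ◅ ss) = ⟶⇒⇛ s ◅ ⟶*⇒⇛* ss

⇛*⇒⟶* : ∀ {n} {t t' : Tm n} → t ⇛* t' → t ⟶* t'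
⇛*⇒⟶* ε        = ε
⇛*⇒⟶* (s ◅ ss) = ⇛⇒⟶* s ◅◅ ⇛*⇒⟶* ss

normal-⟶* : ∀ {n} {u w : Tm n} → Normal u → u ⟶* w → u ≡ w
normal-⟶* nu ε        = refl
normal-⟶* nu (s ◅ ss) = ⊥-elim (nu _ s)

unique-normal-form : ∀ {n} {t u₁ u₂ : Tm n} → t ⟶* u₁ → Normal u₁ → t ⟶* u₂ → Normal u₂ → u₁ ≡ u₂
unique-normal-form s₁ n₁ s₂ n₂ with ⇛*-confluent (⟶*⇒⇛* s₁) (⟶*⇒⇛* s₂)
... | w , a , b = trans (normal-⟶* n₁ (⇛*⇒⟶* a)) (sym (normal-⟶* n₂ (⇛*⇒⟶* b)))

<ᵇ-true : ∀ {k c} → k < c → (k <ᵇ c) ≡ true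
<ᵇ-true {zero}  {suc c} _       = refl
<ᵇ-true {suc k} {suc c} (s≤s p) = <ᵇ-true p

<ᵇ-false : ∀ {k c} → c ≤ k → (k <ᵇ c) ≡ false
<ᵇ-false {k}     {zero}  _       = refl
<ᵇ-false {suc k} {suc c} (s≤s p) = <ᵇ-false p

≡ᵇ-refl : ∀ k → (k ≡ᵇ k) ≡ true
≡ᵇ-refl zero    = refl
≡ᵇ-refl (suc k) = ≡ᵇ-refl k

≡ᵇ-false : ∀ {k j} → j < k → (k ≡ᵇ j) ≡ false
≡ᵇ-false {suc k} {zero}  _       = refl
≡ᵇ-false {suc k} {suc j} (s≤s p) = ≡ᵇ-false p

shift-below : ∀ {k c} → k < c → shiftTy c (tvar k) ≡ tvar k
shift-below p rewrite <ᵇ-true p = refl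

shift-above : ∀ {k c} → c ≤ k → shiftTy c (tvar k) ≡ tvar (suc k)
shift-above p rewrite <ᵇ-false p = refl

substTy-below : ∀ {k j B} → k < j → substTy j B (tvar k) ≡ tvar k
substTy-below p rewrite <ᵇ-true p = refl

substTy-here : ∀ {j B} → substTy j B (tvar j) ≡ B
substTy-here {j} rewrite <ᵇ-false {j} {j} ≤-refl | ≡ᵇ-refl j = refl

substTy-above : ∀ {k j B} → j < k → substTy j B (tvar k) ≡ tvar (pred k)
substTy-above p rewrite <ᵇ-false (<⇒≤ p) | ≡ᵇ-false p = refl

substTy-shiftTy : ∀ j B X → substTy j B (shiftTy j X) ≡ X
substTy-shiftTy j B (tvar k) with <-cmp k j
... | tri< k<j _ _ rewrite shift-below k<j = substTy-below k<j
... | tri≈ _ refl _ rewrite shift-above {k} {k} ≤-refl = substTy-above ≤-refl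
... | tri> _ _ j<k rewrite shift-above (<⇒≤ j<k) = substTy-above (s≤s (<⇒≤ j<k))
substTy-shiftTy j B (X ⊸ Y) = cong₂ _⊸_ (substTy-shiftTy j B X) (substTy-shiftTy j B Y)
substTy-shiftTy j B (X ⇒ Y) = cong₂ _⇒_ (substTy-shiftTy j B X) (substTy-shiftTy j B Y)
substTy-shiftTy j B (§ X)   = cong § (substTy-shiftTy j B X)
substTy-shiftTy j B (⋀ X)   = cong ⋀ (substTy-shiftTy (suc j) (shiftTy 0 B) X)
substTy-shiftTy j B 𝔹       = refl

shiftTy-shiftTy : ∀ c i → c ≤ i → ∀ X → shiftTy (suc i) (shiftTy c X) ≡ shiftTy c (shiftTy i X)
shiftTy-shiftTy c i c≤i (tvar k) with <-cmp k c
... | tri< k<c _ _ rewrite shift-below k<c | shift-below (≤-trans k<c c≤i) | shift-below k<c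
                         | shift-below (m≤n⇒m≤1+n (≤-trans k<c c≤i)) = refl
... | tri≈ _ refl _ with <-cmp k i
...   | tri< k<i _ _ rewrite shift-above {k} {k} ≤-refl | shift-below k<i | shift-below (s≤s k<i)
                           | shift-above {k} {k} ≤-refl = refl
...   | tri≈ _ refl _ rewrite shift-above {k} {k} ≤-refl | shift-above {suc k} {suc k} ≤-refl
                            | shift-above {suc k} {k} (n≤1+n k) = refl
...   | tri> _ _ i<k = ⊥-elim (≤⇒≯ c≤i i<k)
shiftTy-shiftTy c i c≤i (tvar k) | tri> _ _ c<k with <-cmp k i
... | tri< k<i _ _ rewrite shift-above (<⇒≤ c<k) | shift-below k<i | shift-below (s≤s k<i)
                         | shift-above (<⇒≤ c<k) = refl
... | tri≈ _ refl _ rewrite shift-above (<⇒≤ c<k) | shift-above {k} {k} ≤-refl | shift-above {suc k} {suc k} ≤-refl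
                          | shift-above (m≤n⇒m≤1+n (<⇒≤ c<k)) = refl
... | tri> _ _ i<k rewrite shift-above (<⇒≤ c<k) | shift-above (<⇒≤ i<k) | shift-above (s≤s (<⇒≤ i<k))
                         | shift-above (m≤n⇒m≤1+n (<⇒≤ c<k)) = refl
shiftTy-shiftTy c i c≤i (X ⊸ Y) = cong₂ _⊸_ (shiftTy-shiftTy c i c≤i X) (shiftTy-shiftTy c i c≤i Y)
shiftTy-shiftTy c i c≤i (X ⇒ Y) = cong₂ _⇒_ (shiftTy-shiftTy c i c≤i X) (shiftTy-shiftTy c i c≤i Y)
shiftTy-shiftTy c i c≤i (§ X)   = cong § (shiftTy-shiftTy c i c≤i X)
shiftTy-shiftTy c i c≤i (⋀ X)   = cong ⋀ (shiftTy-shiftTy (suc c) (suc i) (s≤s c≤i) X)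
shiftTy-shiftTy c i c≤i 𝔹       = refl

shiftTy-substTy-var : ∀ c j → c ≤ j → ∀ B k → c ≤ k →
                      substTy (suc j) (shiftTy c B) (shiftTy c (tvar k)) ≡ shiftTy c (substTy j B (tvar k))
shiftTy-substTy-var c j c≤j B k c≤k with <-cmp k j
... | tri< k<j _ _ rewrite shift-above c≤k | substTy-below {suc k} {suc j} {shiftTy c B} (s≤s k<j)
                         | substTy-below {k} {j} {B} k<j | shift-above c≤k = refl
... | tri≈ _ refl _ rewrite shift-above c≤k | substTy-here {suc k} {shiftTy c B} | substTy-here {k} {B} = refl
... | tri> _ _ j<k rewrite shift-above c≤k | substTy-above {suc k} {suc j} {shiftTy c B} (s≤s j<k)
                         | substTy-above {k} {j} {B} j<k = unshift k j<k
  where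
  unshift : ∀ k → j < k → tvar k ≡ shiftTy c (tvar (pred k))
  unshift (suc k) (s≤s j≤k) = sym (shift-above (≤-trans c≤j j≤k))

shiftTy-substTy : ∀ c j → c ≤ j → ∀ B X → substTy (suc j) (shiftTy c B) (shiftTy c X) ≡ shiftTy c (substTy j B X)
shiftTy-substTy c j c≤j B (tvar k) with <-cmp k c
... | tri< k<c _ _ rewrite shift-below k<c | substTy-below {k} {suc j} {shiftTy c B} (m≤n⇒m≤1+n (≤-trans k<c c≤j))
                         | substTy-below {k} {j} {B} (≤-trans k<c c≤j) | shift-below k<c = refl
... | tri≈ _ refl _ = shiftTy-substTy-var c j c≤j B k ≤-refl
... | tri> _ _ c<k = shiftTy-substTy-var c j c≤j B k (<⇒≤ c<k)
shiftTy-substTy c j c≤j B (X ⊸ Y) = cong₂ _⊸_ (shiftTy-substTy c j c≤j B X) (shiftTy-substTy c j c≤j B Y)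
shiftTy-substTy c j c≤j B (X ⇒ Y) = cong₂ _⇒_ (shiftTy-substTy c j c≤j B X) (shiftTy-substTy c j c≤j B Y)
shiftTy-substTy c j c≤j B (§ X)   = cong § (shiftTy-substTy c j c≤j B X)
shiftTy-substTy c j c≤j B (⋀ X)   =
  cong ⋀ (trans (cong (λ B' → substTy (suc (suc j)) B' (shiftTy (suc c) X)) (sym (shiftTy-shiftTy 0 c z≤n B)))
                (shiftTy-substTy (suc c) (suc j) (s≤s c≤j) (shiftTy 0 B) X))
shiftTy-substTy c j c≤j B 𝔹       = refl

substTy-substTy-var : ∀ i j → i ≤ j → ∀ B C k →
  substTy j B (substTy i C (tvar k)) ≡ substTy i (substTy j B C) (substTy (suc j) (shiftTy i B) (tvar k))
substTy-substTy-var i j i≤j B C k with <-cmp k i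
... | tri< k<i _ _ rewrite substTy-below {k} {i} {C} k<i | substTy-below {k} {j} {B} (≤-trans k<i i≤j)
                         | substTy-below {k} {suc j} {shiftTy i B} (m≤n⇒m≤1+n (≤-trans k<i i≤j))
                         | substTy-below {k} {i} {substTy j B C} k<i = refl
... | tri≈ _ refl _ rewrite substTy-here {k} {C} | substTy-below {k} {suc j} {shiftTy k B} (s≤s i≤j)
                          | substTy-here {k} {substTy j B C} = refl
... | tri> _ _ i<k = above k i<k
  where
  above : ∀ k → i < k →
    substTy j B (substTy i C (tvar k)) ≡ substTy i (substTy j B C) (substTy (suc j) (shiftTy i B) (tvar k))
  above (suc k) i<k with <-cmp k j
  ... | tri< k<j _ _ rewrite substTy-above {suc k} {i} {C} i<k | substTy-below {k} {j} {B} k<j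
                           | substTy-below {suc k} {suc j} {shiftTy i B} (s≤s k<j)
                           | substTy-above {suc k} {i} {substTy j B C} i<k = refl
  ... | tri≈ _ refl _ rewrite substTy-above {suc k} {i} {C} i<k | substTy-here {k} {B}
                            | substTy-here {suc k} {shiftTy i B} | substTy-shiftTy i (substTy k B C) B = refl
  ... | tri> _ _ j<k rewrite substTy-above {suc k} {i} {C} i<k | substTy-above {k} {j} {B} j<k
                           | substTy-above {suc k} {suc j} {shiftTy i B} (s≤s j<k)
                           | substTy-above {k} {i} {substTy j B C} (≤-trans (s≤s i≤j) j<k) = refl

substTy-substTy : ∀ i j → i ≤ j → ∀ B C X →
  substTy j B (substTy i C X) ≡ substTy i (substTy j B C) (substTy (suc j) (shiftTy i B) X)
substTy-substTy i j i≤j B C (tvar k) = substTy-substTy-var i j i≤j B C k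
substTy-substTy i j i≤j B C (X ⊸ Y)  = cong₂ _⊸_ (substTy-substTy i j i≤j B C X) (substTy-substTy i j i≤j B C Y)
substTy-substTy i j i≤j B C (X ⇒ Y)  = cong₂ _⇒_ (substTy-substTy i j i≤j B C X) (substTy-substTy i j i≤j B C Y)
substTy-substTy i j i≤j B C (§ X)    = cong § (substTy-substTy i j i≤j B C X)
substTy-substTy i j i≤j B C (⋀ X)    =
  cong ⋀ (trans (substTy-substTy (suc i) (suc j) (s≤s i≤j) (shiftTy 0 B) (shiftTy 0 C) X)
                (cong₂ (λ C' B' → substTy (suc i) C' (substTy (suc (suc j)) B' X))
                       (shiftTy-substTy 0 j z≤n B C) (shiftTy-shiftTy 0 i z≤n B)))
substTy-substTy i j i≤j B C 𝔹        = refl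

substTy-§^𝔹 : ∀ j B k → substTy j B (§^ k 𝔹) ≡ §^ k 𝔹
substTy-§^𝔹 j B zero    = refl
substTy-§^𝔹 j B (suc k) = cong § (substTy-§^𝔹 j B k)

substTy-instance : ∀ j B A B' → substTy j B (A [ shiftTy j B' ]ᵀ) ≡ (substTy (suc j) (shiftTy 0 B) A) [ B' ]ᵀ
substTy-instance j B A B' =
  trans (substTy-substTy 0 j z≤n B (shiftTy j B') A)
        (cong (λ C → substTy 0 C (substTy (suc j) (shiftTy 0 B) A)) (substTy-shiftTy j B B'))

-- Annotated terms, their erasure, and their reduction.

-- Annotated terms record the proof structure of a DLAL_B derivation:
-- linear (⊸) and non-linear (⇒) abstractions and applications are kept
-- apart, and a §-box is a body preceded by a telescope of doors.  A door
-- `door d bb` stands for bb[d/0] where d has a §-type (rule §e); the doors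
-- of a box are at the depth of the box, its body one level deeper.
mutual
  data ATm (n : ℕ) : Set where
    rvar      : Fin n → ATm n
    rF rT     : ATm n
    lamL lamN : ATm (suc n) → ATm n
    appL appN : ATm n → ATm n → ATm n
    rite      : ATm n → ATm n → ATm n → ATm n
    box       : ABox n → ATm n

  data ABox (n : ℕ) : Set where
    body : ATm n → ABox n
    door : ATm n → ABox (suc n) → ABox n

mutual
  erase : ∀ {n} → ATm n → Tm n
  erase (rvar x)     = var x
  erase rF           = Fl
  erase rT           = Tr
  erase (lamL t)     = lam (erase t)
  erase (lamN t)     = lam (erase t)
  erase (appL t u)   = app (erase t) (erase u)
  erase (appN t u)   = app (erase t) (erase u)
  erase (rite c a b) = ite (erase c) (erase a) (erase b)
  erase (box bb)     = eraseB bb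

  eraseB : ∀ {n} → ABox n → Tm n
  eraseB (body c)    = erase c
  eraseB (door d bb) = eraseB bb [ erase d ]

mutual
  renA : ∀ {n m} → (Fin n → Fin m) → ATm n → ATm m
  renA ρ (rvar x)     = rvar (ρ x)
  renA ρ rF           = rF
  renA ρ rT           = rT
  renA ρ (lamL t)     = lamL (renA (ext ρ) t)
  renA ρ (lamN t)     = lamN (renA (ext ρ) t)
  renA ρ (appL t u)   = appL (renA ρ t) (renA ρ u)
  renA ρ (appN t u)   = appN (renA ρ t) (renA ρ u)
  renA ρ (rite c a b) = rite (renA ρ c) (renA ρ a) (renA ρ b)
  renA ρ (box bb)     = box (renB ρ bb)

  renB : ∀ {n m} → (Fin n → Fin m) → ABox n → ABox m
  renB ρ (body c)    = body (renA ρ c)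
  renB ρ (door d bb) = door (renA ρ d) (renB (ext ρ) bb)

extsA : ∀ {n m} → (Fin n → ATm m) → Fin (suc n) → ATm (suc m)
extsA σ zero    = rvar zero
extsA σ (suc x) = renA suc (σ x)

mutual
  subA : ∀ {n m} → (Fin n → ATm m) → ATm n → ATm m
  subA σ (rvar x)     = σ x
  subA σ rF           = rF
  subA σ rT           = rT
  subA σ (lamL t)     = lamL (subA (extsA σ) t)
  subA σ (lamN t)     = lamN (subA (extsA σ) t)
  subA σ (appL t u)   = appL (subA σ t) (subA σ u)
  subA σ (appN t u)   = appN (subA σ t) (subA σ u)
  subA σ (rite c a b) = rite (subA σ c) (subA σ a) (subA σ b)
  subA σ (box bb)     = box (subB σ bb)

  subB : ∀ {n m} → (Fin n → ATm m) → ABox n → ABox m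
  subB σ (body c)    = body (subA σ c)
  subB σ (door d bb) = door (subA σ d) (subB (extsA σ) bb)

singleA : ∀ {n} → ATm n → Fin (suc n) → ATm n
singleA u zero    = u
singleA u (suc x) = rvar x

_[_]ᴬ : ∀ {n} → ATm (suc n) → ATm n → ATm n
t [ u ]ᴬ = subA (singleA u) t

-- Opening a box plugged into a door: `door (box bb') bb` becomes a single
-- box whose doors are those of bb' followed by those of bb, and whose body
-- is bb's body with bb''s body substituted.
mergeB : ∀ {n} → ABox n → ABox (suc n) → ABox n
mergeB (body s)      bb = subB (singleA s) bb
mergeB (door d bb')  bb = door d (mergeB bb' (renB (ext suc) bb))

mutual
  erase-renA : ∀ {n m} (ρ : Fin n → Fin m) r → erase (renA ρ r) ≡ rename ρ (erase r)
  erase-renA ρ (rvar x)     = refl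
  erase-renA ρ rF           = refl
  erase-renA ρ rT           = refl
  erase-renA ρ (lamL t)     = cong lam (erase-renA (ext ρ) t)
  erase-renA ρ (lamN t)     = cong lam (erase-renA (ext ρ) t)
  erase-renA ρ (appL t u)   = cong₂ app (erase-renA ρ t) (erase-renA ρ u)
  erase-renA ρ (appN t u)   = cong₂ app (erase-renA ρ t) (erase-renA ρ u)
  erase-renA ρ (rite c a b) = cong₃ ite (erase-renA ρ c) (erase-renA ρ a) (erase-renA ρ b)
  erase-renA ρ (box bb)     = eraseB-renB ρ bb

  eraseB-renB : ∀ {n m} (ρ : Fin n → Fin m) bb → eraseB (renB ρ bb) ≡ rename ρ (eraseB bb)
  eraseB-renB ρ (body c)    = erase-renA ρ c
  eraseB-renB ρ (door d bb) =
    trans (cong₂ _[_] (eraseB-renB (ext ρ) bb) (erase-renA ρ d)) (sym (rename-[] ρ (eraseB bb) (erase d)))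

erase-extsA : ∀ {n m} (σ : Fin n → ATm m) x → erase (extsA σ x) ≡ exts (λ y → erase (σ y)) x
erase-extsA σ zero    = refl
erase-extsA σ (suc x) = erase-renA suc (σ x)

mutual
  erase-subA : ∀ {n m} (σ : Fin n → ATm m) r → erase (subA σ r) ≡ subst (λ x → erase (σ x)) (erase r)
  erase-subA σ (rvar x)     = refl
  erase-subA σ rF           = refl
  erase-subA σ rT           = refl
  erase-subA σ (lamL t)     = cong lam (trans (erase-subA (extsA σ) t) (subst-cong (erase-extsA σ) (erase t)))
  erase-subA σ (lamN t)     = cong lam (trans (erase-subA (extsA σ) t) (subst-cong (erase-extsA σ) (erase t)))
  erase-subA σ (appL t u)   = cong₂ app (erase-subA σ t) (erase-subA σ u)
  erase-subA σ (appN t u)   = cong₂ app (erase-subA σ t) (erase-subA σ u)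
  erase-subA σ (rite c a b) = cong₃ ite (erase-subA σ c) (erase-subA σ a) (erase-subA σ b)
  erase-subA σ (box bb)     = eraseB-subB σ bb

  eraseB-subB : ∀ {n m} (σ : Fin n → ATm m) bb → eraseB (subB σ bb) ≡ subst (λ x → erase (σ x)) (eraseB bb)
  eraseB-subB σ (body c)    = erase-subA σ c
  eraseB-subB σ (door d bb) =
    trans (cong₂ _[_] (trans (eraseB-subB (extsA σ) bb) (subst-cong (erase-extsA σ) (eraseB bb))) (erase-subA σ d))
          (sym (subst-[] (λ x → erase (σ x)) (eraseB bb) (erase d)))

erase-singleA : ∀ {n} (u : ATm n) x → erase (singleA u x) ≡ single (erase u) x
erase-singleA u zero    = refl
erase-singleA u (suc x) = refl

erase-[]ᴬ : ∀ {n} (t : ATm (suc n)) (u : ATm n) → erase (t [ u ]ᴬ) ≡ erase t [ erase u ]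
erase-[]ᴬ t u =
  trans (erase-subA (singleA u) t) (trans (subst-cong (erase-singleA u) (erase t)) (sym ([]-as-subst (erase t) (erase u))))

eraseB-mergeB : ∀ {n} (bb' : ABox n) (bb : ABox (suc n)) → eraseB (mergeB bb' bb) ≡ eraseB bb [ eraseB bb' ]
eraseB-mergeB (body s) bb =
  trans (eraseB-subB (singleA s) bb)
        (trans (subst-cong (erase-singleA s) (eraseB bb)) (sym ([]-as-subst (eraseB bb) (erase s))))
eraseB-mergeB (door d bb') bb = begin
    eraseB (mergeB bb' (renB (ext suc) bb)) [ erase d ]
      ≡⟨ cong (_[ erase d ]) (trans (eraseB-mergeB bb' (renB (ext suc) bb))
                                    (cong (_[ eraseB bb' ]) (eraseB-renB (ext suc) bb))) ⟩
    (t↑ [ eraseB bb' ]) [ erase d ]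
      ≡⟨ trans ([]-as-subst (t↑ [ eraseB bb' ]) (erase d)) (cong (subst (single (erase d))) ([]-as-subst t↑ (eraseB bb'))) ⟩
    subst (single (erase d)) (subst (single (eraseB bb')) t↑)
      ≡⟨ trans (subst-subst (single (erase d)) (single (eraseB bb')) t↑)
               (subst-rename (λ x → subst (single (erase d)) (single (eraseB bb') x)) (ext suc) (eraseB bb)) ⟩
    subst (λ x → subst (single (erase d)) (single (eraseB bb') (ext suc x))) (eraseB bb)
      ≡⟨ subst-cong pointwise (eraseB bb) ⟩
    subst (single (eraseB bb' [ erase d ])) (eraseB bb)
      ≡⟨ sym ([]-as-subst (eraseB bb) (eraseB bb' [ erase d ])) ⟩
    eraseB bb [ eraseB bb' [ erase d ] ] ∎
  where
  open ≡-Reasoning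
  t↑ : Tm (suc (suc _))
  t↑ = rename (ext suc) (eraseB bb)
  pointwise : ∀ x → subst (single (erase d)) (single (eraseB bb') (ext suc x)) ≡ single (eraseB bb' [ erase d ]) x
  pointwise zero    = sym ([]-as-subst (eraseB bb') (erase d))
  pointwise (suc x) = refl

-- Reduction of annotated terms.  Besides β and δ (whose condition is
-- checked on the erasure) there is `merge`, which opens a box sitting in a
-- door; it is invisible after erasure.
infix 4 _↝_ _↝B_
mutual
  data _↝_ {n : ℕ} : ATm n → ATm n → Set where
    βL     : ∀ {t u} → appL (lamL t) u ↝ t [ u ]ᴬ
    βN     : ∀ {t u} → appN (lamN t) u ↝ t [ u ]ᴬ
    δT'    : ∀ {c a b} → erase c ≡ Tr → rite c a b ↝ a
    δF'    : ∀ {c a b} → erase c ≡ Fl → rite c a b ↝ b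
    ξlamL  : ∀ {t t'} → t ↝ t' → lamL t ↝ lamL t'
    ξlamN  : ∀ {t t'} → t ↝ t' → lamN t ↝ lamN t'
    ξappLl : ∀ {t t' u} → t ↝ t' → appL t u ↝ appL t' u
    ξappLr : ∀ {t u u'} → u ↝ u' → appL t u ↝ appL t u'
    ξappNl : ∀ {t t' u} → t ↝ t' → appN t u ↝ appN t' u
    ξappNr : ∀ {t u u'} → u ↝ u' → appN t u ↝ appN t u'
    ξrite₀ : ∀ {c c' a b} → c ↝ c' → rite c a b ↝ rite c' a b
    ξrite₁ : ∀ {c a a' b} → a ↝ a' → rite c a b ↝ rite c a' b
    ξrite₂ : ∀ {c a b b'} → b ↝ b' → rite c a b ↝ rite c a b'
    ξbox   : ∀ {bb bb'} → bb ↝B bb' → box bb ↝ box bb'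

  data _↝B_ {n : ℕ} : ABox n → ABox n → Set where
    merge  : ∀ {bb' bb} → door (box bb') bb ↝B mergeB bb' bb
    ξbody  : ∀ {c c'} → c ↝ c' → body c ↝B body c'
    ξdoorl : ∀ {d d' bb} → d ↝ d' → door d bb ↝B door d' bb
    ξdoorr : ∀ {d bb bb'} → bb ↝B bb' → door d bb ↝B door d bb'

mutual
  erase-↝ : ∀ {n} {r r' : ATm n} → r ↝ r' → erase r ⟶* erase r'
  erase-↝ (βL {t} {u})        = transport (app (lam (erase t)) (erase u) ⟶*_) (sym (erase-[]ᴬ t u)) (β ◅ ε)
  erase-↝ (βN {t} {u})        = transport (app (lam (erase t)) (erase u) ⟶*_) (sym (erase-[]ᴬ t u)) (β ◅ ε)
  erase-↝ (δT' {c} {a} {b} e) = transport (λ z → ite z (erase a) (erase b) ⟶* erase a) (sym e) (δT ◅ ε)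
  erase-↝ (δF' {c} {a} {b} e) = transport (λ z → ite z (erase a) (erase b) ⟶* erase b) (sym e) (δF ◅ ε)
  erase-↝ (ξlamL s)           = lam* (erase-↝ s)
  erase-↝ (ξlamN s)           = lam* (erase-↝ s)
  erase-↝ (ξappLl s)          = app* (erase-↝ s) ε
  erase-↝ (ξappLr s)          = app* ε (erase-↝ s)
  erase-↝ (ξappNl s)          = app* (erase-↝ s) ε
  erase-↝ (ξappNr s)          = app* ε (erase-↝ s)
  erase-↝ (ξrite₀ s)          = ite* (erase-↝ s) ε ε
  erase-↝ (ξrite₁ s)          = ite* ε (erase-↝ s) ε
  erase-↝ (ξrite₂ s)          = ite* ε ε (erase-↝ s)
  erase-↝ (ξbox s)            = eraseB-↝B s

  eraseB-↝B : ∀ {n} {bb bb' : ABox n} → bb ↝B bb' → eraseB bb ⟶* eraseB bb'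
  eraseB-↝B (merge {bb'} {bb})      = transport (eraseB bb [ eraseB bb' ] ⟶*_) (sym (eraseB-mergeB bb' bb)) ε
  eraseB-↝B (ξbody s)               = erase-↝ s
  eraseB-↝B (ξdoorl {bb = bb} s)    = []-⟶*ʳ (eraseB bb) (erase-↝ s)
  eraseB-↝B (ξdoorr {d} s)          = []-⟶*ˡ (erase d) (eraseB-↝B s)

ind : ∀ {n} → Fin n → Fin n → ℕ
ind zero    zero    = 1
ind zero    (suc y) = 0
ind (suc x) zero    = 0
ind (suc x) (suc y) = ind x y

ind-refl : ∀ {n} (x : Fin n) → ind x x ≡ 1
ind-refl zero    = refl
ind-refl (suc x) = ind-refl x

ind-≢ : ∀ {n} {x y : Fin n} → ¬ x ≡ y → ind x y ≡ 0
ind-≢ {x = zero}  {zero}  x≢y = ⊥-elim (x≢y refl)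
ind-≢ {x = zero}  {suc y} x≢y = refl
ind-≢ {x = suc x} {zero}  x≢y = refl
ind-≢ {x = suc x} {suc y} x≢y = ind-≢ (λ e → x≢y (cong suc e))

ind-sym : ∀ {n} (x y : Fin n) → ind x y ≡ ind y x
ind-sym zero    zero    = refl
ind-sym zero    (suc y) = refl
ind-sym (suc x) zero    = refl
ind-sym (suc x) (suc y) = ind-sym x y

ind≤1 : ∀ {n} (x y : Fin n) → ind x y ≤ 1
ind≤1 zero    zero    = ≤-refl
ind≤1 zero    (suc y) = z≤n
ind≤1 (suc x) zero    = z≤n
ind≤1 (suc x) (suc y) = ind≤1 x y

-- occ x r counts the occurrences of x in r.  The branches of an if share
-- their resources, so they count by maximum rather than by sum.
mutual
  occ : ∀ {n} → Fin n → ATm n → ℕ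
  occ x (rvar y)     = ind x y
  occ x rF           = 0
  occ x rT           = 0
  occ x (lamL t)     = occ (suc x) t
  occ x (lamN t)     = occ (suc x) t
  occ x (appL t u)   = occ x t + occ x u
  occ x (appN t u)   = occ x t + occ x u
  occ x (rite c a b) = occ x c ⊔ (occ x a ⊔ occ x b)
  occ x (box bb)     = occB x bb

  occB : ∀ {n} → Fin n → ABox n → ℕ
  occB x (body c)    = occ x c
  occB x (door d bb) = occ x d + occB (suc x) bb

-- occ0 x r counts only the occurrences at depth 0, i.e. not inside the
-- argument of a non-linear application and not inside the body of a box.
mutual
  occ0 : ∀ {n} → Fin n → ATm n → ℕ
  occ0 x (rvar y)     = ind x y
  occ0 x rF           = 0
  occ0 x rT           = 0
  occ0 x (lamL t)     = occ0 (suc x) t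
  occ0 x (lamN t)     = occ0 (suc x) t
  occ0 x (appL t u)   = occ0 x t + occ0 x u
  occ0 x (appN t u)   = occ0 x t
  occ0 x (rite c a b) = occ0 x c ⊔ (occ0 x a ⊔ occ0 x b)
  occ0 x (box bb)     = occB0 x bb

  occB0 : ∀ {n} → Fin n → ABox n → ℕ
  occB0 x (body c)    = 0
  occB0 x (door d bb) = occ0 x d + occB0 (suc x) bb

occ0≤occ : ∀ {n} (x : Fin n) r → occ0 x r ≤ occ x r
occ0≤occ x (rvar y)     = ≤-refl
occ0≤occ x rF           = z≤n
occ0≤occ x rT           = z≤n
occ0≤occ x (lamL t)     = occ0≤occ (suc x) t
occ0≤occ x (lamN t)     = occ0≤occ (suc x) t
occ0≤occ x (appL t u)   = +-mono-≤ (occ0≤occ x t) (occ0≤occ x u)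
occ0≤occ x (appN t u)   = ≤-trans (occ0≤occ x t) (m≤m+n _ _)
occ0≤occ x (rite c a b) = ⊔-mono-≤ (occ0≤occ x c) (⊔-mono-≤ (occ0≤occ x a) (occ0≤occ x b))
occ0≤occ x (box bb)     = occB0≤occB x bb
  where
  occB0≤occB : ∀ {n} (x : Fin n) bb → occB0 x bb ≤ occB x bb
  occB0≤occB x (body c)    = z≤n
  occB0≤occB x (door d bb) = +-mono-≤ (occ0≤occ x d) (occB0≤occB (suc x) bb)

InjectiveAt : ∀ {n m} → (Fin n → Fin m) → Fin n → Set
InjectiveAt ρ x = ∀ y → ρ y ≡ ρ x → y ≡ x

Misses : ∀ {n m} → (Fin n → Fin m) → Fin m → Set
Misses ρ z = ∀ y → ¬ ρ y ≡ z

ext-injectiveAt : ∀ {n m} (ρ : Fin n → Fin m) x → InjectiveAt ρ x → InjectiveAt (ext ρ) (suc x)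
ext-injectiveAt ρ x inj zero    ()
ext-injectiveAt ρ x inj (suc y) e = cong suc (inj y (Fin.suc-injective e))

ext-injectiveAt-zero : ∀ {n m} (ρ : Fin n → Fin m) → InjectiveAt (ext ρ) zero
ext-injectiveAt-zero ρ zero    e = refl
ext-injectiveAt-zero ρ (suc y) ()

ext-misses : ∀ {n m} (ρ : Fin n → Fin m) z → Misses ρ z → Misses (ext ρ) (suc z)
ext-misses ρ z miss zero    ()
ext-misses ρ z miss (suc y) e = miss y (Fin.suc-injective e)

ind-rename : ∀ {n m} (ρ : Fin n → Fin m) x y → InjectiveAt ρ x → ind (ρ x) (ρ y) ≡ ind x y
ind-rename ρ x y inj with x Fin.≟ y
... | yes refl = trans (ind-refl (ρ x)) (sym (ind-refl x))
... | no x≢y   = trans (ind-≢ (λ e → x≢y (sym (inj y (sym e))))) (sym (ind-≢ x≢y))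

mutual
  occ-renA : ∀ {n m} (ρ : Fin n → Fin m) x → InjectiveAt ρ x → ∀ r → occ (ρ x) (renA ρ r) ≡ occ x r
  occ-renA ρ x inj (rvar y)     = ind-rename ρ x y inj
  occ-renA ρ x inj rF           = refl
  occ-renA ρ x inj rT           = refl
  occ-renA ρ x inj (lamL t)     = occ-renA (ext ρ) (suc x) (ext-injectiveAt ρ x inj) t
  occ-renA ρ x inj (lamN t)     = occ-renA (ext ρ) (suc x) (ext-injectiveAt ρ x inj) t
  occ-renA ρ x inj (appL t u)   = cong₂ _+_ (occ-renA ρ x inj t) (occ-renA ρ x inj u)
  occ-renA ρ x inj (appN t u)   = cong₂ _+_ (occ-renA ρ x inj t) (occ-renA ρ x inj u)
  occ-renA ρ x inj (rite c a b) = cong₂ _⊔_ (occ-renA ρ x inj c) (cong₂ _⊔_ (occ-renA ρ x inj a) (occ-renA ρ x inj b))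
  occ-renA ρ x inj (box bb)     = occB-renB ρ x inj bb

  occB-renB : ∀ {n m} (ρ : Fin n → Fin m) x → InjectiveAt ρ x → ∀ bb → occB (ρ x) (renB ρ bb) ≡ occB x bb
  occB-renB ρ x inj (body c)    = occ-renA ρ x inj c
  occB-renB ρ x inj (door d bb) = cong₂ _+_ (occ-renA ρ x inj d) (occB-renB (ext ρ) (suc x) (ext-injectiveAt ρ x inj) bb)

mutual
  occ0-renA : ∀ {n m} (ρ : Fin n → Fin m) x → InjectiveAt ρ x → ∀ r → occ0 (ρ x) (renA ρ r) ≡ occ0 x r
  occ0-renA ρ x inj (rvar y)     = ind-rename ρ x y inj
  occ0-renA ρ x inj rF           = refl
  occ0-renA ρ x inj rT           = refl
  occ0-renA ρ x inj (lamL t)     = occ0-renA (ext ρ) (suc x) (ext-injectiveAt ρ x inj) t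
  occ0-renA ρ x inj (lamN t)     = occ0-renA (ext ρ) (suc x) (ext-injectiveAt ρ x inj) t
  occ0-renA ρ x inj (appL t u)   = cong₂ _+_ (occ0-renA ρ x inj t) (occ0-renA ρ x inj u)
  occ0-renA ρ x inj (appN t u)   = occ0-renA ρ x inj t
  occ0-renA ρ x inj (rite c a b) = cong₂ _⊔_ (occ0-renA ρ x inj c) (cong₂ _⊔_ (occ0-renA ρ x inj a) (occ0-renA ρ x inj b))
  occ0-renA ρ x inj (box bb)     = occB0-renB ρ x inj bb

  occB0-renB : ∀ {n m} (ρ : Fin n → Fin m) x → InjectiveAt ρ x → ∀ bb → occB0 (ρ x) (renB ρ bb) ≡ occB0 x bb
  occB0-renB ρ x inj (body c)    = refl
  occB0-renB ρ x inj (door d bb) = cong₂ _+_ (occ0-renA ρ x inj d) (occB0-renB (ext ρ) (suc x) (ext-injectiveAt ρ x inj) bb)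

mutual
  occ-renA-miss : ∀ {n m} (ρ : Fin n → Fin m) z → Misses ρ z → ∀ r → occ z (renA ρ r) ≡ 0
  occ-renA-miss ρ z miss (rvar y)     = ind-≢ (λ e → miss y (sym e))
  occ-renA-miss ρ z miss rF           = refl
  occ-renA-miss ρ z miss rT           = refl
  occ-renA-miss ρ z miss (lamL t)     = occ-renA-miss (ext ρ) (suc z) (ext-misses ρ z miss) t
  occ-renA-miss ρ z miss (lamN t)     = occ-renA-miss (ext ρ) (suc z) (ext-misses ρ z miss) t
  occ-renA-miss ρ z miss (appL t u)   = cong₂ _+_ (occ-renA-miss ρ z miss t) (occ-renA-miss ρ z miss u)
  occ-renA-miss ρ z miss (appN t u)   = cong₂ _+_ (occ-renA-miss ρ z miss t) (occ-renA-miss ρ z miss u)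
  occ-renA-miss ρ z miss (rite c a b) =
    cong₂ _⊔_ (occ-renA-miss ρ z miss c) (cong₂ _⊔_ (occ-renA-miss ρ z miss a) (occ-renA-miss ρ z miss b))
  occ-renA-miss ρ z miss (box bb)     = occB-renB-miss ρ z miss bb

  occB-renB-miss : ∀ {n m} (ρ : Fin n → Fin m) z → Misses ρ z → ∀ bb → occB z (renB ρ bb) ≡ 0
  occB-renB-miss ρ z miss (body c)    = occ-renA-miss ρ z miss c
  occB-renB-miss ρ z miss (door d bb) =
    cong₂ _+_ (occ-renA-miss ρ z miss d) (occB-renB-miss (ext ρ) (suc z) (ext-misses ρ z miss) bb)

occ-suc : ∀ {n} (x : Fin n) r → occ (suc x) (renA suc r) ≡ occ x r
occ-suc x r = occ-renA suc x (λ y → Fin.suc-injective) r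

occ-zero-renA-suc : ∀ {n} (r : ATm n) → occ zero (renA suc r) ≡ 0
occ-zero-renA-suc r = occ-renA-miss suc zero (λ y ()) r

occ-zero-renA-ext : ∀ {n m} (ρ : Fin n → Fin m) r → occ zero (renA (ext ρ) r) ≡ occ zero r
occ-zero-renA-ext ρ r = occ-renA (ext ρ) zero (ext-injectiveAt-zero ρ) r

occB-zero-renB-ext : ∀ {n m} (ρ : Fin n → Fin m) bb → occB zero (renB (ext ρ) bb) ≡ occB zero bb
occB-zero-renB-ext ρ bb = occB-renB (ext ρ) zero (ext-injectiveAt-zero ρ) bb

occB0-zero-renB-ext : ∀ {n m} (ρ : Fin n → Fin m) → ∀ bb → occB0 zero (renB (ext ρ) bb) ≡ occB0 zero bb
occB0-zero-renB-ext ρ bb = occB0-renB (ext ρ) zero (ext-injectiveAt-zero ρ) bb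

mutual
  occ-subA-var : ∀ {n m} (σ : Fin n → ATm m) x₀ z → σ x₀ ≡ rvar z → (∀ y → ¬ y ≡ x₀ → occ z (σ y) ≡ 0) →
                 ∀ r → occ z (subA σ r) ≡ occ x₀ r
  occ-subA-var σ x₀ z e h (rvar y) with y Fin.≟ x₀
  ... | yes refl = trans (cong (occ z) e) (trans (ind-refl z) (sym (ind-refl x₀)))
  ... | no y≢x₀  = trans (h y y≢x₀) (sym (ind-≢ (λ e' → y≢x₀ (sym e'))))
  occ-subA-var σ x₀ z e h rF           = refl
  occ-subA-var σ x₀ z e h rT           = refl
  occ-subA-var σ x₀ z e h (lamL t)     = occ-subA-var (extsA σ) (suc x₀) (suc z) (cong (renA suc) e) (extsA-avoids σ x₀ z h) t
  occ-subA-var σ x₀ z e h (lamN t)     = occ-subA-var (extsA σ) (suc x₀) (suc z) (cong (renA suc) e) (extsA-avoids σ x₀ z h) t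
  occ-subA-var σ x₀ z e h (appL t u)   = cong₂ _+_ (occ-subA-var σ x₀ z e h t) (occ-subA-var σ x₀ z e h u)
  occ-subA-var σ x₀ z e h (appN t u)   = cong₂ _+_ (occ-subA-var σ x₀ z e h t) (occ-subA-var σ x₀ z e h u)
  occ-subA-var σ x₀ z e h (rite c a b) =
    cong₂ _⊔_ (occ-subA-var σ x₀ z e h c) (cong₂ _⊔_ (occ-subA-var σ x₀ z e h a) (occ-subA-var σ x₀ z e h b))
  occ-subA-var σ x₀ z e h (box bb)     = occB-subB-var σ x₀ z e h bb

  occB-subB-var : ∀ {n m} (σ : Fin n → ATm m) x₀ z → σ x₀ ≡ rvar z → (∀ y → ¬ y ≡ x₀ → occ z (σ y) ≡ 0) →
                  ∀ bb → occB z (subB σ bb) ≡ occB x₀ bb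
  occB-subB-var σ x₀ z e h (body c)    = occ-subA-var σ x₀ z e h c
  occB-subB-var σ x₀ z e h (door d bb) =
    cong₂ _+_ (occ-subA-var σ x₀ z e h d)
              (occB-subB-var (extsA σ) (suc x₀) (suc z) (cong (renA suc) e) (extsA-avoids σ x₀ z h) bb)

  extsA-avoids : ∀ {n m} (σ : Fin n → ATm m) x₀ z → (∀ y → ¬ y ≡ x₀ → occ z (σ y) ≡ 0) →
                 ∀ y → ¬ y ≡ suc x₀ → occ (suc z) (extsA σ y) ≡ 0
  extsA-avoids σ x₀ z h zero    _  = refl
  extsA-avoids σ x₀ z h (suc y) ne = trans (occ-suc z (σ y)) (h y (λ e → ne (cong suc e)))

extsA-zero-avoids : ∀ {n m} (σ : Fin n → ATm m) y → ¬ y ≡ zero → occ zero (extsA σ y) ≡ 0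
extsA-zero-avoids σ zero    ne = ⊥-elim (ne refl)
extsA-zero-avoids σ (suc y) ne = occ-zero-renA-suc (σ y)

occ-zero-subA-extsA : ∀ {n m} (σ : Fin n → ATm m) r → occ zero (subA (extsA σ) r) ≡ occ zero r
occ-zero-subA-extsA σ r = occ-subA-var (extsA σ) zero zero refl (extsA-zero-avoids σ) r

occB-zero-subB-extsA : ∀ {n m} (σ : Fin n → ATm m) bb → occB zero (subB (extsA σ) bb) ≡ occB zero bb
occB-zero-subB-extsA σ bb = occB-subB-var (extsA σ) zero zero refl (extsA-zero-avoids σ) bb

sumF : ∀ n → (Fin n → ℕ) → ℕ
sumF zero    f = 0
sumF (suc n) f = f zero + sumF n (λ z → f (suc z))

sumF-cong : ∀ n {f g : Fin n → ℕ} → (∀ z → f z ≡ g z) → sumF n f ≡ sumF n g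
sumF-cong zero    h = refl
sumF-cong (suc n) h = cong₂ _+_ (h zero) (sumF-cong n (λ z → h (suc z)))

sumF-mono : ∀ n {f g : Fin n → ℕ} → (∀ z → f z ≤ g z) → sumF n f ≤ sumF n g
sumF-mono zero    h = z≤n
sumF-mono (suc n) h = +-mono-≤ (h zero) (sumF-mono n (λ z → h (suc z)))

sumF-+ : ∀ n (f g : Fin n → ℕ) → sumF n (λ z → f z + g z) ≡ sumF n f + sumF n g
sumF-+ zero    f g = refl
sumF-+ (suc n) f g =
  trans (cong ((f zero + g zero) +_) (sumF-+ n (λ z → f (suc z)) (λ z → g (suc z))))
        (interchange (f zero) (g zero) _ _)

sumF-zero : ∀ n → sumF n (λ z → 0) ≡ 0
sumF-zero zero    = refl
sumF-zero (suc n) = sumF-zero n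

sumF-ind : ∀ n (x : Fin n) (g : Fin n → ℕ) → sumF n (λ z → ind z x * g z) ≡ g x
sumF-ind (suc n) zero    g = trans (cong (λ w → g zero + 0 + w) (sumF-zero n)) (trans (+-identityʳ _) (+-identityʳ _))
sumF-ind (suc n) (suc x) g = sumF-ind n x (λ z → g (suc z))

sumF-ind' : ∀ n (y : Fin n) (f : Fin n → ℕ) → sumF n (λ z → f z * ind y z) ≡ f y
sumF-ind' n y f =
  trans (sumF-cong n (λ z → trans (*-comm (f z) (ind y z)) (cong (_* f z) (ind-sym y z)))) (sumF-ind n y f)

OccBound : ∀ {n m} (σ : Fin n → ATm m) (y : Fin m) (occ-r : Fin n → ℕ) → ℕ
OccBound {n} σ y occ-r = sumF n (λ z → occ-r z * occ y (σ z))

OccBound-+ : ∀ {n m} (σ : Fin n → ATm m) y (f g : Fin n → ℕ) →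
             OccBound σ y f + OccBound σ y g ≡ OccBound σ y (λ z → f z + g z)
OccBound-+ {n} σ y f g =
  trans (sym (sumF-+ n _ _)) (sumF-cong n (λ z → sym (*-distribʳ-+ (occ y (σ z)) (f z) (g z))))

OccBound-mono : ∀ {n m} (σ : Fin n → ATm m) y {f g : Fin n → ℕ} → (∀ z → f z ≤ g z) →
                OccBound σ y f ≤ OccBound σ y g
OccBound-mono {n} σ y h = sumF-mono n (λ z → *-monoˡ-≤ (occ y (σ z)) (h z))

OccBound-extsA : ∀ {n m} (σ : Fin n → ATm m) y (f : Fin (suc n) → ℕ) →
                 OccBound (extsA σ) (suc y) f ≡ OccBound σ y (λ z → f (suc z))
OccBound-extsA {n} σ y f =
  trans (cong (_+ sumF n (λ z → f (suc z) * occ (suc y) (renA suc (σ z)))) (*-zeroʳ (f zero)))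
        (sumF-cong n (λ z → cong (f (suc z) *_) (occ-suc y (σ z))))

mutual
  occ-subA : ∀ {n m} (σ : Fin n → ATm m) y r → occ y (subA σ r) ≤ OccBound σ y (λ z → occ z r)
  occ-subA {n} σ y (rvar x)     = ≤-reflexive (sym (sumF-ind n x (λ z → occ y (σ z))))
  occ-subA σ y rF               = z≤n
  occ-subA σ y rT               = z≤n
  occ-subA σ y (lamL t)         =
    ≤-trans (occ-subA (extsA σ) (suc y) t) (≤-reflexive (OccBound-extsA σ y (λ z → occ z t)))
  occ-subA σ y (lamN t)         =
    ≤-trans (occ-subA (extsA σ) (suc y) t) (≤-reflexive (OccBound-extsA σ y (λ z → occ z t)))
  occ-subA σ y (appL t u)       =
    ≤-trans (+-mono-≤ (occ-subA σ y t) (occ-subA σ y u)) (≤-reflexive (OccBound-+ σ y (λ z → occ z t) (λ z → occ z u)))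
  occ-subA σ y (appN t u)       =
    ≤-trans (+-mono-≤ (occ-subA σ y t) (occ-subA σ y u)) (≤-reflexive (OccBound-+ σ y (λ z → occ z t) (λ z → occ z u)))
  occ-subA σ y (rite c a b)     =
    ⊔-lub (≤-trans (occ-subA σ y c) (OccBound-mono σ y (λ z → m≤m⊔n (occ z c) (occ z a ⊔ occ z b))))
          (⊔-lub (≤-trans (occ-subA σ y a)
                          (OccBound-mono σ y (λ z → ≤-trans (m≤m⊔n (occ z a) (occ z b))
                                                            (m≤n⊔m (occ z c) (occ z a ⊔ occ z b)))))
                 (≤-trans (occ-subA σ y b)
                          (OccBound-mono σ y (λ z → ≤-trans (m≤n⊔m (occ z a) (occ z b))
                                                            (m≤n⊔m (occ z c) (occ z a ⊔ occ z b))))))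
  occ-subA σ y (box bb)         = occB-subB σ y bb

  occB-subB : ∀ {n m} (σ : Fin n → ATm m) y bb → occB y (subB σ bb) ≤ OccBound σ y (λ z → occB z bb)
  occB-subB σ y (body c)    = occ-subA σ y c
  occB-subB σ y (door d bb) =
    ≤-trans (+-mono-≤ (occ-subA σ y d)
                      (≤-trans (occB-subB (extsA σ) (suc y) bb) (≤-reflexive (OccBound-extsA σ y (λ z → occB z bb)))))
            (≤-reflexive (OccBound-+ σ y (λ z → occ z d) (λ z → occB (suc z) bb)))

occ-[]ᴬ : ∀ {n} (t : ATm (suc n)) (u : ATm n) y → occ y (t [ u ]ᴬ) ≤ occ zero t * occ y u + occ (suc y) t
occ-[]ᴬ {n} t u y =
  ≤-trans (occ-subA (singleA u) y t) (≤-reflexive (cong (occ zero t * occ y u +_) (sumF-ind' n y (λ z → occ (suc z) t))))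

occB-singleA : ∀ {n} (bb : ABox (suc n)) (u : ATm n) y →
               occB y (subB (singleA u) bb) ≤ occB zero bb * occ y u + occB (suc y) bb
occB-singleA {n} bb u y =
  ≤-trans (occB-subB (singleA u) y bb) (≤-reflexive (cong (occB zero bb * occ y u +_) (sumF-ind' n y (λ z → occB (suc z) bb))))

-- The annotated type system and its weakening, renaming and substitution lemmas.

-- The status of a variable in an environment: absent, linear, non-linear,
-- or shared (a non-linear variable seen one depth further in, where it may
-- be used freely but no longer abstracted).
data Entry : Set where
  dnone         : Entry
  dlin dnl dshr : Ty → Entry

Env : ℕ → Set
Env n = Fin n → Entry

infixr 5 _∷ₑ_
_∷ₑ_ : ∀ {n} → Entry → Env n → Env (suc n)
(s ∷ₑ E) zero    = s
(s ∷ₑ E) (suc x) = E x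

-- Going one depth deeper (into a box body or a non-linear argument):
-- linear variables become unavailable and non-linear ones shared.
hideS : Entry → Entry
hideS (dnl A) = dshr A
hideS _       = dnone

hide : ∀ {n} → Env n → Env n
hide E x = hideS (E x)

data Usable : Entry → Ty → Set where
  ulin : ∀ {A} → Usable (dlin A) A
  ushr : ∀ {A} → Usable (dshr A) A

infix 4 _≼_ _≥_
data _≼_ : Entry → Entry → Set where
  ≼refl : ∀ {s} → s ≼ s
  ≼none : ∀ {s} → dnone ≼ s
  ≼ls   : ∀ {A} → dlin A ≼ dshr A

≡⇒≼ : ∀ {s s'} → s ≡ s' → s ≼ s'
≡⇒≼ refl = ≼refl

usable-≼ : ∀ {s s' A} → Usable s A → s ≼ s' → Usable s' A
usable-≼ u    ≼refl = u
usable-≼ ulin ≼ls   = ushr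

hide-≼ : ∀ {s s'} → s ≼ s' → hideS s ≼ hideS s'
hide-≼ ≼refl = ≼refl
hide-≼ ≼none = ≼none
hide-≼ ≼ls   = ≼refl

data _≥_ : Ty → Ty → Set where
  ≥refl : ∀ {A} → A ≥ A
  ≥inst : ∀ {A T} B → (A [ B ]ᵀ) ≥ T → ⋀ A ≥ T

-- L ∣ E ⊩ r ∶ A: r has type A in E with depth budget L.  A linear abstraction uses its
-- variable at most once.  ∀-introduction is infinitary (all instances),
-- which makes type substitution admissible.  A box is typed by BTy L Eo Ei,
-- where doors are typed in the outer environment Eo (budget L+1) and bind
-- linear variables of the inner environment Ei of the body (budget L).
infix 3 _∣_⊩_∶_
mutual
  data _∣_⊩_∶_ {n : ℕ} : ℕ → Env n → ATm n → Ty → Set where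
    tvar  : ∀ {L E x A T} → Usable (E x) A → A ≥ T → L ∣ E ⊩ rvar x ∶ T
    tF    : ∀ {L E} → L ∣ E ⊩ rF ∶ 𝔹
    tT    : ∀ {L E} → L ∣ E ⊩ rT ∶ 𝔹
    tlamL : ∀ {L E t A B} → occ zero t ≤ 1 → L ∣ dlin A ∷ₑ E ⊩ t ∶ B → L ∣ E ⊩ lamL t ∶ A ⊸ B
    tlamN : ∀ {L E t A B} → L ∣ dnl A ∷ₑ E ⊩ t ∶ B → L ∣ E ⊩ lamN t ∶ A ⇒ B
    tappL : ∀ {L E t u A D T} → L ∣ E ⊩ t ∶ A ⊸ D → L ∣ E ⊩ u ∶ A → D ≥ T → L ∣ E ⊩ appL t u ∶ T
    tappN : ∀ {L E t u A D T} → suc L ∣ E ⊩ t ∶ A ⇒ D → L ∣ hide E ⊩ u ∶ A → D ≥ T → suc L ∣ E ⊩ appN t u ∶ T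
    tite  : ∀ {L E c a b T} k → L ∣ E ⊩ c ∶ §^ k 𝔹 → L ∣ E ⊩ a ∶ T → L ∣ E ⊩ b ∶ T →
            L ∣ E ⊩ rite c a b ∶ T
    tbox  : ∀ {L E bb A} → BTy L E (hide E) bb A → suc L ∣ E ⊩ box bb ∶ § A
    t∀    : ∀ {L E r A} → (∀ B → L ∣ E ⊩ r ∶ A [ B ]ᵀ) → L ∣ E ⊩ r ∶ ⋀ A

  data BTy {n : ℕ} (L : ℕ) : Env n → Env n → ABox n → Ty → Set where
    tbody : ∀ {Eo Ei c A} → L ∣ Ei ⊩ c ∶ A → BTy L Eo Ei (body c) A
    tdoor : ∀ {Eo Ei d bb A B} → suc L ∣ Eo ⊩ d ∶ § B → occB zero bb ≤ 1 →
            BTy L (dnone ∷ₑ Eo) (dlin B ∷ₑ Ei) bb A → BTy L Eo Ei (door d bb) A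

≥-snoc : ∀ {A C} B → A ≥ ⋀ C → A ≥ C [ B ]ᵀ
≥-snoc B ≥refl        = ≥inst B ≥refl
≥-snoc B (≥inst B' p) = ≥inst B' (≥-snoc B p)

∀-elim : ∀ {n L} {E : Env n} {r A} B → L ∣ E ⊩ r ∶ ⋀ A → L ∣ E ⊩ r ∶ A [ B ]ᵀ
∀-elim B (tvar u g)          = tvar u (≥-snoc B g)
∀-elim B (tappL d₁ d₂ g)     = tappL d₁ d₂ (≥-snoc B g)
∀-elim B (tappN d₁ d₂ g)     = tappN d₁ d₂ (≥-snoc B g)
∀-elim B (tite k d₀ d₁ d₂)   = tite k d₀ (∀-elim B d₁) (∀-elim B d₂)
∀-elim B (t∀ f)              = f B

instantiate : ∀ {n L} {E : Env n} {r A T} → L ∣ E ⊩ r ∶ A → A ≥ T → L ∣ E ⊩ r ∶ T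
instantiate d ≥refl       = d
instantiate d (≥inst B p) = instantiate (∀-elim B d) p

mutual
  weaken : ∀ {n L} {E E' : Env n} {r A} → (∀ x → E x ≼ E' x) → L ∣ E ⊩ r ∶ A → L ∣ E' ⊩ r ∶ A
  weaken h (tvar {x = x} u g) = tvar (usable-≼ u (h x)) g
  weaken h tF                 = tF
  weaken h tT                 = tT
  weaken h (tlamL p d)        = tlamL p (weaken (λ { zero → ≼refl ; (suc x) → h x }) d)
  weaken h (tlamN d)          = tlamN (weaken (λ { zero → ≼refl ; (suc x) → h x }) d)
  weaken h (tappL d₁ d₂ g)    = tappL (weaken h d₁) (weaken h d₂) g
  weaken h (tappN d₁ d₂ g)    = tappN (weaken h d₁) (weaken (λ x → hide-≼ (h x)) d₂) g
  weaken h (tite k d₀ d₁ d₂)  = tite k (weaken h d₀) (weaken h d₁) (weaken h d₂)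
  weaken h (tbox b)           = tbox (weakenB h (λ x → hide-≼ (h x)) b)
  weaken h (t∀ f)             = t∀ (λ B → weaken h (f B))

  weakenB : ∀ {n L} {Eo Eo' Ei Ei' : Env n} {bb A} → (∀ x → Eo x ≼ Eo' x) → (∀ x → Ei x ≼ Ei' x) →
            BTy L Eo Ei bb A → BTy L Eo' Ei' bb A
  weakenB ho hi (tbody d)     = tbody (weaken hi d)
  weakenB ho hi (tdoor d p b) =
    tdoor (weaken ho d) p (weakenB (λ { zero → ≼refl ; (suc x) → ho x }) (λ { zero → ≼refl ; (suc x) → hi x }) b)

env-cong : ∀ {n L} {E E' : Env n} {r A} → (∀ x → E x ≡ E' x) → L ∣ E ⊩ r ∶ A → L ∣ E' ⊩ r ∶ A
env-cong h = weaken (λ x → ≡⇒≼ (h x))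

ext-≼ : ∀ {n m} {E : Env n} {E' : Env m} {ρ : Fin n → Fin m} s →
        (∀ x → E x ≼ E' (ρ x)) → ∀ x → (s ∷ₑ E) x ≼ (s ∷ₑ E') (ext ρ x)
ext-≼ s h zero    = ≼refl
ext-≼ s h (suc x) = h x

mutual
  rename-⊩ : ∀ {n m L} {E : Env n} {E' : Env m} {r A} (ρ : Fin n → Fin m) → (∀ x → E x ≼ E' (ρ x)) →
             L ∣ E ⊩ r ∶ A → L ∣ E' ⊩ renA ρ r ∶ A
  rename-⊩ ρ h (tvar {x = x} u g)  = tvar (usable-≼ u (h x)) g
  rename-⊩ ρ h tF                  = tF
  rename-⊩ ρ h tT                  = tT
  rename-⊩ ρ h (tlamL {t = t} p d) =
    tlamL (transport (_≤ 1) (sym (occ-zero-renA-ext ρ t)) p) (rename-⊩ (ext ρ) (ext-≼ _ h) d)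
  rename-⊩ ρ h (tlamN d)           = tlamN (rename-⊩ (ext ρ) (ext-≼ _ h) d)
  rename-⊩ ρ h (tappL d₁ d₂ g)     = tappL (rename-⊩ ρ h d₁) (rename-⊩ ρ h d₂) g
  rename-⊩ ρ h (tappN d₁ d₂ g)     = tappN (rename-⊩ ρ h d₁) (rename-⊩ ρ (λ x → hide-≼ (h x)) d₂) g
  rename-⊩ ρ h (tite k d₀ d₁ d₂)   = tite k (rename-⊩ ρ h d₀) (rename-⊩ ρ h d₁) (rename-⊩ ρ h d₂)
  rename-⊩ ρ h (tbox b)            = tbox (renameB-⊩ ρ h (λ x → hide-≼ (h x)) b)
  rename-⊩ ρ h (t∀ f)              = t∀ (λ B → rename-⊩ ρ h (f B))

  renameB-⊩ : ∀ {n m L} {Eo Ei : Env n} {Eo' Ei' : Env m} {bb A} (ρ : Fin n → Fin m) →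
              (∀ x → Eo x ≼ Eo' (ρ x)) → (∀ x → Ei x ≼ Ei' (ρ x)) → BTy L Eo Ei bb A → BTy L Eo' Ei' (renB ρ bb) A
  renameB-⊩ ρ ho hi (tbody d)               = tbody (rename-⊩ ρ hi d)
  renameB-⊩ ρ ho hi (tdoor {bb = bb} d p b) =
    tdoor (rename-⊩ ρ ho d) (transport (_≤ 1) (sym (occB-zero-renB-ext ρ bb)) p)
          (renameB-⊩ (ext ρ) (ext-≼ _ ho) (ext-≼ _ hi) b)

weaken-suc : ∀ {n L} {E : Env n} {r A} s → L ∣ E ⊩ r ∶ A → L ∣ s ∷ₑ E ⊩ renA suc r ∶ A
weaken-suc s d = rename-⊩ suc (λ x → ≼refl) d

-- A well-typed substitution from E to E' at budget L: every usable variable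
-- is replaced by a term of its type, and every non-linear variable by a term
-- typable one depth deeper (it may be copied into non-linear arguments).
SubstOK : ∀ {n m} → ℕ → (Fin n → ATm m) → Env n → Env m → Set
SubstOK {n} L σ E E' =
  ∀ (x : Fin n) → (∀ {A} → Usable (E x) A → L ∣ E' ⊩ σ x ∶ A) ×
                  (∀ {A} → E x ≡ dnl A → pred L ∣ hide E' ⊩ σ x ∶ A)

hide-SubstOK : ∀ {n m L} {σ : Fin n → ATm m} {E E'} → SubstOK (suc L) σ E E' → SubstOK L σ (hide E) (hide E')
hide-SubstOK {E = E} h x = usable (E x) refl , nonlinear (E x) refl
  where
  usable : ∀ s → E x ≡ s → ∀ {A} → Usable (hideS s) A → _
  usable (dnl A) e ushr = proj₂ (h x) e
  nonlinear : ∀ s → E x ≡ s → ∀ {A} → hideS s ≡ dnl A → _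
  nonlinear dnone    e ()
  nonlinear (dlin _) e ()
  nonlinear (dnl _)  e ()
  nonlinear (dshr _) e ()

extsA-SubstOK : ∀ {n m L} {σ : Fin n → ATm m} {E E'} s → SubstOK L σ E E' → SubstOK L (extsA σ) (s ∷ₑ E) (s ∷ₑ E')
extsA-SubstOK s h zero    = (λ u → tvar u ≥refl) , (λ { refl → tvar ushr ≥refl })
extsA-SubstOK s h (suc x) = (λ u → weaken-suc s (proj₁ (h x) u)) , (λ e → rename-⊩ suc (λ y → ≼refl) (proj₂ (h x) e))

mutual
  subst-⊩ : ∀ {n m L} {σ : Fin n → ATm m} {E E' r A} → SubstOK L σ E E' → L ∣ E ⊩ r ∶ A → L ∣ E' ⊩ subA σ r ∶ A
  subst-⊩ h (tvar {x = x} u g)          = instantiate (proj₁ (h x) u) g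
  subst-⊩ h tF                          = tF
  subst-⊩ h tT                          = tT
  subst-⊩ {σ = σ} h (tlamL {t = t} p d) =
    tlamL (transport (_≤ 1) (sym (occ-zero-subA-extsA σ t)) p) (subst-⊩ (extsA-SubstOK _ h) d)
  subst-⊩ h (tlamN d)                   = tlamN (subst-⊩ (extsA-SubstOK _ h) d)
  subst-⊩ h (tappL d₁ d₂ g)             = tappL (subst-⊩ h d₁) (subst-⊩ h d₂) g
  subst-⊩ h (tappN d₁ d₂ g)             = tappN (subst-⊩ h d₁) (subst-⊩ (hide-SubstOK h) d₂) g
  subst-⊩ h (tite k d₀ d₁ d₂)           = tite k (subst-⊩ h d₀) (subst-⊩ h d₁) (subst-⊩ h d₂)
  subst-⊩ h (tbox b)                    = tbox (substB-⊩ h (hide-SubstOK h) b)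
  subst-⊩ h (t∀ f)                      = t∀ (λ B → subst-⊩ h (f B))

  substB-⊩ : ∀ {n m L} {σ : Fin n → ATm m} {Eo Ei Eo' Ei' bb A} → SubstOK (suc L) σ Eo Eo' → SubstOK L σ Ei Ei' →
             BTy L Eo Ei bb A → BTy L Eo' Ei' (subB σ bb) A
  substB-⊩ ho hi (tbody d)                         = tbody (subst-⊩ hi d)
  substB-⊩ {σ = σ} ho hi (tdoor {bb = bb} d p b) =
    tdoor (subst-⊩ ho d) (transport (_≤ 1) (sym (occB-zero-subB-extsA σ bb)) p)
          (substB-⊩ (extsA-SubstOK _ ho) (extsA-SubstOK _ hi) b)

mutual
  absent-occ : ∀ {n L} {E : Env n} {r A} y → L ∣ E ⊩ r ∶ A → E y ≡ dnone → occ y r ≡ 0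
  absent-occ y (tvar {x = x} u g) e with y Fin.≟ x
  ... | yes refl = ⊥-elim (unusable (transport (λ s → Usable s _) e u))
    where
    unusable : ∀ {A} → ¬ Usable dnone A
    unusable ()
  ... | no y≢x   = ind-≢ y≢x
  absent-occ y tF                e = refl
  absent-occ y tT                e = refl
  absent-occ y (tlamL p d)       e = absent-occ (suc y) d e
  absent-occ y (tlamN d)         e = absent-occ (suc y) d e
  absent-occ y (tappL d₁ d₂ g)   e = cong₂ _+_ (absent-occ y d₁ e) (absent-occ y d₂ e)
  absent-occ y (tappN d₁ d₂ g)   e = cong₂ _+_ (absent-occ y d₁ e) (absent-occ y d₂ (cong hideS e))
  absent-occ y (tite k d₀ d₁ d₂) e
    rewrite absent-occ y d₀ e | absent-occ y d₁ e | absent-occ y d₂ e = refl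
  absent-occ y (tbox b)          e = absent-occB y b e (cong hideS e)
  absent-occ y (t∀ f)            e = absent-occ y (f 𝔹) e

  absent-occB : ∀ {n L} {Eo Ei : Env n} {bb A} y → BTy L Eo Ei bb A → Eo y ≡ dnone → Ei y ≡ dnone → occB y bb ≡ 0
  absent-occB y (tbody d)     eo ei = absent-occ y d ei
  absent-occB y (tdoor d p b) eo ei = cong₂ _+_ (absent-occ y d eo) (absent-occB (suc y) b eo ei)

NotAtDepth0 : Entry → Set
NotAtDepth0 dnone   = ⊤
NotAtDepth0 (dnl _) = ⊤
NotAtDepth0 _       = ⊥

-- Such variables do not occur at depth 0; in particular a non-linear
-- β-redex does not duplicate anything at depth 0.
mutual
  notAtDepth0-occ0 : ∀ {n L} {E : Env n} {r A} y → L ∣ E ⊩ r ∶ A → NotAtDepth0 (E y) → occ0 y r ≡ 0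
  notAtDepth0-occ0 y (tvar {x = x} u g) h with y Fin.≟ x
  ... | yes refl = ⊥-elim (unusable u h)
    where
    unusable : ∀ {s A} → Usable s A → ¬ NotAtDepth0 s
    unusable ulin ()
    unusable ushr ()
  ... | no y≢x   = ind-≢ y≢x
  notAtDepth0-occ0 y tF                h = refl
  notAtDepth0-occ0 y tT                h = refl
  notAtDepth0-occ0 y (tlamL p d)       h = notAtDepth0-occ0 (suc y) d h
  notAtDepth0-occ0 y (tlamN d)         h = notAtDepth0-occ0 (suc y) d h
  notAtDepth0-occ0 y (tappL d₁ d₂ g)   h = cong₂ _+_ (notAtDepth0-occ0 y d₁ h) (notAtDepth0-occ0 y d₂ h)
  notAtDepth0-occ0 y (tappN d₁ d₂ g)   h = notAtDepth0-occ0 y d₁ h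
  notAtDepth0-occ0 y (tite k d₀ d₁ d₂) h
    rewrite notAtDepth0-occ0 y d₀ h | notAtDepth0-occ0 y d₁ h | notAtDepth0-occ0 y d₂ h = refl
  notAtDepth0-occ0 y (tbox b)          h = notAtDepth0-occB0 y b h
  notAtDepth0-occ0 y (t∀ f)            h = notAtDepth0-occ0 y (f 𝔹) h

  notAtDepth0-occB0 : ∀ {n L} {Eo Ei : Env n} {bb A} y → BTy L Eo Ei bb A → NotAtDepth0 (Eo y) → occB0 y bb ≡ 0
  notAtDepth0-occB0 y (tbody d)     h = refl
  notAtDepth0-occB0 y (tdoor d p b) h = cong₂ _+_ (notAtDepth0-occ0 y d h) (notAtDepth0-occB0 (suc y) b h)

NotDuplicable : Entry → Set
NotDuplicable dnone    = ⊤
NotDuplicable (dlin _) = ⊤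
NotDuplicable _        = ⊥

notDuplicable-hide : ∀ s → NotDuplicable s → hideS s ≡ dnone
notDuplicable-hide dnone    _ = refl
notDuplicable-hide (dlin _) _ = refl

notDuplicable-hide' : ∀ s → NotDuplicable s → NotDuplicable (hideS s)
notDuplicable-hide' s k rewrite notDuplicable-hide s k = tt

-- Substituting u for a variable occurring at most once adds at most occ y u.
linear-copy-bound : ∀ a b c → a ≤ 1 → a * b + c ≤ c + b
linear-copy-bound a b c a≤1 =
  ≤-trans (+-monoˡ-≤ c (≤-trans (*-monoˡ-≤ b a≤1) (≤-reflexive (+-identityʳ b)))) (≤-reflexive (+-comm b c))

-- Occurrences after merging boxes: the inner box's body occurs once.
occB-mergeB : ∀ {n} (bb' : ABox n) (bb : ABox (suc n)) → occB zero bb ≤ 1 →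
              ∀ y → occB y (mergeB bb' bb) ≤ occB y bb' + occB (suc y) bb
occB-mergeB (body s) bb p y =
  ≤-trans (occB-singleA bb s y)
          (≤-trans (linear-copy-bound (occB zero bb) (occ y s) (occB (suc y) bb) p)
                   (≤-reflexive (+-comm (occB (suc y) bb) (occ y s))))
occB-mergeB (door d bb') bb p y =
  ≤-trans (+-monoʳ-≤ (occ y d) (occB-mergeB bb' bb↑ (≤-trans (≤-reflexive (occB-zero-renB-ext suc bb)) p) (suc y)))
          (≤-reflexive (trans (cong (λ w → occ y d + (occB (suc y) bb' + w)) occ-bb↑) (sym (+-assoc (occ y d) _ _))))
  where
  bb↑ = renB (ext suc) bb
  occ-bb↑ : occB (suc (suc y)) bb↑ ≡ occB (suc y) bb
  occ-bb↑ = occB-renB (ext suc) (suc y) (ext-injectiveAt suc y (λ _ → Fin.suc-injective)) bb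

mutual
  occ-↝ : ∀ {n L} {E : Env n} {r r' A} → L ∣ E ⊩ r ∶ A → r ↝ r' → ∀ y → NotDuplicable (E y) → occ y r' ≤ occ y r
  occ-↝ (t∀ f) s y k = occ-↝ (f 𝔹) s y k
  occ-↝ (tappL (tlamL {t = t} p d₁) d₂ g) (βL {u = u}) y k = ≤-trans (occ-[]ᴬ t u y) (linear-copy-bound _ _ _ p)
  occ-↝ (tappL d₁ d₂ g) (ξappLl s) y k = +-monoˡ-≤ _ (occ-↝ d₁ s y k)
  occ-↝ (tappL d₁ d₂ g) (ξappLr s) y k = +-monoʳ-≤ _ (occ-↝ d₂ s y k)
  occ-↝ {E = E} (tappN (tlamN {t = t} d₁) d₂ g) (βN {u = u}) y k =
    ≤-trans (occ-[]ᴬ t u y)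
            (≤-trans (≤-reflexive (trans (cong (λ w → occ zero t * w + occ (suc y) t)
                                               (absent-occ y d₂ (notDuplicable-hide (E y) k)))
                                         (cong (_+ occ (suc y) t) (*-zeroʳ (occ zero t)))))
                     (m≤m+n _ _))
  occ-↝ (tappN d₁ d₂ g) (ξappNl s) y k = +-monoˡ-≤ _ (occ-↝ d₁ s y k)
  occ-↝ {E = E} (tappN d₁ d₂ g) (ξappNr s) y k = +-monoʳ-≤ _ (occ-↝ d₂ s y (notDuplicable-hide' (E y) k))
  occ-↝ (tite _ d₀ d₁ d₂) (δT' {c} {a} {b} e) y k =
    ≤-trans (m≤m⊔n (occ y a) (occ y b)) (m≤n⊔m (occ y c) (occ y a ⊔ occ y b))
  occ-↝ (tite _ d₀ d₁ d₂) (δF' {c} {a} {b} e) y k =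
    ≤-trans (m≤n⊔m (occ y a) (occ y b)) (m≤n⊔m (occ y c) (occ y a ⊔ occ y b))
  occ-↝ (tite _ d₀ d₁ d₂) (ξrite₀ {a = a} {b} s) y k = ⊔-mono-≤ (occ-↝ d₀ s y k) (≤-refl {occ y a ⊔ occ y b})
  occ-↝ (tite _ d₀ d₁ d₂) (ξrite₁ {c} {b = b} s) y k =
    ⊔-mono-≤ (≤-refl {occ y c}) (⊔-mono-≤ (occ-↝ d₁ s y k) (≤-refl {occ y b}))
  occ-↝ (tite _ d₀ d₁ d₂) (ξrite₂ {c} {a} s) y k =
    ⊔-mono-≤ (≤-refl {occ y c}) (⊔-mono-≤ (≤-refl {occ y a}) (occ-↝ d₂ s y k))
  occ-↝ (tlamL p d) (ξlamL s) y k = occ-↝ d s (suc y) k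
  occ-↝ (tlamN d) (ξlamN s) y k = occ-↝ d s (suc y) k
  occ-↝ {E = E} (tbox b) (ξbox s) y k = occB-↝B b s y k (notDuplicable-hide' (E y) k)

  occB-↝B : ∀ {n L} {Eo Ei : Env n} {bb bb' A} → BTy L Eo Ei bb A → bb ↝B bb' →
            ∀ y → NotDuplicable (Eo y) → NotDuplicable (Ei y) → occB y bb' ≤ occB y bb
  occB-↝B (tdoor d p b) (merge {bb'} {bb}) y ko ki = occB-mergeB bb' bb p y
  occB-↝B (tbody d)     (ξbody s)          y ko ki = occ-↝ d s y ki
  occB-↝B (tdoor d p b) (ξdoorl s)         y ko ki = +-monoˡ-≤ _ (occ-↝ d s y ko)
  occB-↝B (tdoor d p b) (ξdoorr s)         y ko ki = +-monoʳ-≤ _ (occB-↝B b s (suc y) ko ki)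

singleA-SubstOK : ∀ {n L} {E : Env n} {u : ATm n} s →
                  (∀ {A} → Usable s A → L ∣ E ⊩ u ∶ A) → (∀ {A} → s ≡ dnl A → pred L ∣ hide E ⊩ u ∶ A) →
                  SubstOK L (singleA u) (s ∷ₑ E) E
singleA-SubstOK s usable nonlinear zero    = usable , nonlinear
singleA-SubstOK s usable nonlinear (suc x) =
  (λ u → tvar u ≥refl) , (λ e → tvar (transport (λ s → Usable (hideS s) _) (sym e) ushr) ≥refl)

mergeB-⊩ : ∀ {n L} {Eo Ei Ei' : Env n} {bb' bb A B} → BTy L Eo Ei' bb' B → (∀ x → Ei' x ≼ Ei x) →
           BTy L (dnone ∷ₑ Eo) (dlin B ∷ₑ Ei) bb A → occB zero bb ≤ 1 → BTy L Eo Ei (mergeB bb' bb) A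
mergeB-⊩ (tbody d) h b p =
  substB-⊩ (singleA-SubstOK dnone (λ ()) (λ ())) (singleA-SubstOK (dlin _) (λ { ulin → weaken h d }) (λ ())) b
mergeB-⊩ {Eo = Eo} {Ei} {bb' = door d' bb''} {bb} (tdoor {B = C} dd p' b') h b p =
  tdoor dd linear (mergeB-⊩ b' (λ { zero → ≼refl ; (suc x) → h x }) b↑ p↑)
  where
  bb↑ = renB (ext suc) bb
  b↑ : BTy _ (dnone ∷ₑ dnone ∷ₑ Eo) (_ ∷ₑ dlin C ∷ₑ Ei) bb↑ _
  b↑ = renameB-⊩ (ext suc) (λ { zero → ≼refl ; (suc x) → ≼refl }) (λ { zero → ≼refl ; (suc x) → ≼refl }) b
  p↑ : occB zero bb↑ ≤ 1
  p↑ = ≤-trans (≤-reflexive (occB-zero-renB-ext suc bb)) p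
  fresh : occB (suc zero) bb↑ ≡ 0
  fresh = occB-renB-miss (ext suc) (suc zero) (λ { zero () ; (suc y) () }) bb
  linear : occB zero (mergeB bb'' bb↑) ≤ 1
  linear = ≤-trans (occB-mergeB bb'' bb↑ p↑ zero)
                   (≤-trans (≤-reflexive (trans (cong (occB zero bb'' +_) fresh) (+-identityʳ _))) p')

mutual
  preservation : ∀ {n L} {E : Env n} {r r' A} → L ∣ E ⊩ r ∶ A → r ↝ r' → L ∣ E ⊩ r' ∶ A
  preservation (t∀ f)                    s          = t∀ (λ B → preservation (f B) s)
  preservation (tappL (tlamL p d₁) d₂ g) βL         =
    instantiate (subst-⊩ (singleA-SubstOK (dlin _) (λ { ulin → d₂ }) (λ ())) d₁) g
  preservation (tappL d₁ d₂ g)           (ξappLl s) = tappL (preservation d₁ s) d₂ g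
  preservation (tappL d₁ d₂ g)           (ξappLr s) = tappL d₁ (preservation d₂ s) g
  preservation (tappN (tlamN d₁) d₂ g)   βN         =
    instantiate (subst-⊩ (singleA-SubstOK (dnl _) (λ ()) (λ { refl → d₂ })) d₁) g
  preservation (tappN d₁ d₂ g)           (ξappNl s) = tappN (preservation d₁ s) d₂ g
  preservation (tappN d₁ d₂ g)           (ξappNr s) = tappN d₁ (preservation d₂ s) g
  preservation (tite k d₀ d₁ d₂)         (δT' e)    = d₁
  preservation (tite k d₀ d₁ d₂)         (δF' e)    = d₂
  preservation (tite k d₀ d₁ d₂)         (ξrite₀ s) = tite k (preservation d₀ s) d₁ d₂
  preservation (tite k d₀ d₁ d₂)         (ξrite₁ s) = tite k d₀ (preservation d₁ s) d₂
  preservation (tite k d₀ d₁ d₂)         (ξrite₂ s) = tite k d₀ d₁ (preservation d₂ s)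
  preservation (tlamL p d)               (ξlamL s)  = tlamL (≤-trans (occ-↝ d s zero tt) p) (preservation d s)
  preservation (tlamN d)                 (ξlamN s)  = tlamN (preservation d s)
  preservation (tbox b)                  (ξbox s)   = tbox (preservationB b (λ x → ≼refl) s)

  preservationB : ∀ {n L} {Eo Ei : Env n} {bb bb' A} → BTy L Eo Ei bb A → (∀ x → hideS (Eo x) ≼ Ei x) →
                  bb ↝B bb' → BTy L Eo Ei bb' A
  preservationB (tdoor (tbox b') p b) h merge      = mergeB-⊩ b' h b p
  preservationB (tbody d)             h (ξbody s)  = tbody (preservation d s)
  preservationB (tdoor d p b)         h (ξdoorl s) = tdoor (preservation d s) p b
  preservationB (tdoor d p b)         h (ξdoorr s) =
    tdoor d (≤-trans (occB-↝B b s zero tt tt) p) (preservationB b (λ { zero → ≼none ; (suc x) → h x }) s)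

-- Weights of annotated terms, depth by depth.

-- At depth 0 the weight is
-- multiplicative in linear applications (so that a linear β-step, which
-- copies its argument at most once, strictly decreases it), ignores the
-- arguments of non-linear applications and box bodies (which live deeper),
-- and counts the doors of a box.  At depth d+1 it adds up the depth-d
-- weights of the non-linear arguments and box bodies.
mutual
  W : ∀ {n} → ℕ → ATm n → ℕ
  W zero    (rvar _)     = 1
  W zero    rF           = 1
  W zero    rT           = 1
  W zero    (lamL t)     = suc (W zero t)
  W zero    (lamN t)     = suc (W zero t)
  W zero    (appL t u)   = suc (W zero t * W zero u)
  W zero    (appN t u)   = suc (W zero t)
  W zero    (rite c a b) = suc (W zero c + (W zero a + W zero b))
  W zero    (box bb)     = suc (suc (WB zero bb))
  W (suc d) (rvar _)     = 0
  W (suc d) rF           = 0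
  W (suc d) rT           = 0
  W (suc d) (lamL t)     = W (suc d) t
  W (suc d) (lamN t)     = W (suc d) t
  W (suc d) (appL t u)   = W (suc d) t + W (suc d) u
  W (suc d) (appN t u)   = W (suc d) t + W d u
  W (suc d) (rite c a b) = W (suc d) c + (W (suc d) a + W (suc d) b)
  W (suc d) (box bb)     = WB (suc d) bb

  WB : ∀ {n} → ℕ → ABox n → ℕ
  WB zero    (body c)    = 0
  WB zero    (door e bb) = W zero e + WB zero bb
  WB (suc d) (body c)    = W d c
  WB (suc d) (door e bb) = W (suc d) e + WB (suc d) bb

-- The depth-0 weight is positive, so it can be a multiplicative factor.
W0-pos : ∀ {n} (r : ATm n) → 1 ≤ W zero r
W0-pos (rvar x)     = s≤s z≤n
W0-pos rF           = s≤s z≤n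
W0-pos rT           = s≤s z≤n
W0-pos (lamL r)     = s≤s z≤n
W0-pos (lamN r)     = s≤s z≤n
W0-pos (appL r u)   = s≤s z≤n
W0-pos (appN r u)   = s≤s z≤n
W0-pos (rite c a b) = s≤s z≤n
W0-pos (box bb)     = s≤s z≤n

mutual
  W-renA : ∀ {n m} (ρ : Fin n → Fin m) d r → W d (renA ρ r) ≡ W d r
  W-renA ρ zero    (rvar x)     = refl
  W-renA ρ zero    rF           = refl
  W-renA ρ zero    rT           = refl
  W-renA ρ zero    (lamL t)     = cong suc (W-renA (ext ρ) zero t)
  W-renA ρ zero    (lamN t)     = cong suc (W-renA (ext ρ) zero t)
  W-renA ρ zero    (appL t u)   = cong suc (cong₂ _*_ (W-renA ρ zero t) (W-renA ρ zero u))
  W-renA ρ zero    (appN t u)   = cong suc (W-renA ρ zero t)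
  W-renA ρ zero    (rite c a b) = cong suc (cong₂ _+_ (W-renA ρ zero c) (cong₂ _+_ (W-renA ρ zero a) (W-renA ρ zero b)))
  W-renA ρ zero    (box bb)     = cong (λ z → suc (suc z)) (WB-renB ρ zero bb)
  W-renA ρ (suc d) (rvar x)     = refl
  W-renA ρ (suc d) rF           = refl
  W-renA ρ (suc d) rT           = refl
  W-renA ρ (suc d) (lamL t)     = W-renA (ext ρ) (suc d) t
  W-renA ρ (suc d) (lamN t)     = W-renA (ext ρ) (suc d) t
  W-renA ρ (suc d) (appL t u)   = cong₂ _+_ (W-renA ρ (suc d) t) (W-renA ρ (suc d) u)
  W-renA ρ (suc d) (appN t u)   = cong₂ _+_ (W-renA ρ (suc d) t) (W-renA ρ d u)
  W-renA ρ (suc d) (rite c a b) = cong₂ _+_ (W-renA ρ (suc d) c) (cong₂ _+_ (W-renA ρ (suc d) a) (W-renA ρ (suc d) b))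
  W-renA ρ (suc d) (box bb)     = WB-renB ρ (suc d) bb

  WB-renB : ∀ {n m} (ρ : Fin n → Fin m) d bb → WB d (renB ρ bb) ≡ WB d bb
  WB-renB ρ zero    (body c)    = refl
  WB-renB ρ zero    (door e bb) = cong₂ _+_ (W-renA ρ zero e) (WB-renB (ext ρ) zero bb)
  WB-renB ρ (suc d) (body c)    = W-renA ρ d c
  WB-renB ρ (suc d) (door e bb) = cong₂ _+_ (W-renA ρ (suc d) e) (WB-renB (ext ρ) (suc d) bb)

RenamingExcept : ∀ {n m} → (Fin n → ATm m) → Fin n → Set
RenamingExcept {n} {m} σ i = ∀ z → ¬ z ≡ i → Σ (Fin m) (λ w → σ z ≡ rvar w)

extsA-RenamingExcept : ∀ {n m} {σ : Fin n → ATm m} {i} → RenamingExcept σ i → RenamingExcept (extsA σ) (suc i)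
extsA-RenamingExcept h zero    ne = zero , refl
extsA-RenamingExcept h (suc z) ne with h z (λ e → ne (cong suc e))
... | w , e = suc w , cong (renA suc) e

singleA-RenamingExcept : ∀ {n} (u : ATm n) → RenamingExcept (singleA u) zero
singleA-RenamingExcept u zero    ne = ⊥-elim (ne refl)
singleA-RenamingExcept u (suc z) ne = z , refl

⊔≡0 : ∀ a b → a ⊔ b ≡ 0 → (a ≡ 0) × (b ≡ 0)
⊔≡0 a b e = n≤0⇒n≡0 (≤-trans (m≤m⊔n a b) (≤-reflexive e)) , n≤0⇒n≡0 (≤-trans (m≤n⊔m a b) (≤-reflexive e))

mutual
  W0-subA-unused : ∀ {n m} (σ : Fin n → ATm m) i → RenamingExcept σ i → ∀ t → occ0 i t ≡ 0 →
                   W zero (subA σ t) ≡ W zero t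
  W0-subA-unused σ i h (rvar y) e with y Fin.≟ i
  ... | yes refl = ⊥-elim (1≢0 (trans (sym (ind-refl i)) e))
    where
    1≢0 : ¬ 1 ≡ 0
    1≢0 ()
  ... | no y≢i with h y y≢i
  ...   | w , σy≡w rewrite σy≡w = refl
  W0-subA-unused σ i h rF e = refl
  W0-subA-unused σ i h rT e = refl
  W0-subA-unused σ i h (lamL t) e = cong suc (W0-subA-unused (extsA σ) (suc i) (extsA-RenamingExcept h) t e)
  W0-subA-unused σ i h (lamN t) e = cong suc (W0-subA-unused (extsA σ) (suc i) (extsA-RenamingExcept h) t e)
  W0-subA-unused σ i h (appL t u) e =
    cong suc (cong₂ _*_ (W0-subA-unused σ i h t (m+n≡0⇒m≡0 _ e)) (W0-subA-unused σ i h u (m+n≡0⇒n≡0 _ e)))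
  W0-subA-unused σ i h (appN t u) e = cong suc (W0-subA-unused σ i h t e)
  W0-subA-unused σ i h (rite c a b) e with ⊔≡0 (occ0 i c) _ e
  ... | e-c , e-ab with ⊔≡0 (occ0 i a) _ e-ab
  ...   | e-a , e-b =
    cong suc (cong₂ _+_ (W0-subA-unused σ i h c e-c) (cong₂ _+_ (W0-subA-unused σ i h a e-a) (W0-subA-unused σ i h b e-b)))
  W0-subA-unused σ i h (box bb) e = cong (λ z → suc (suc z)) (WB0-subB-unused σ i h bb e)

  WB0-subB-unused : ∀ {n m} (σ : Fin n → ATm m) i → RenamingExcept σ i → ∀ bb → occB0 i bb ≡ 0 →
                    WB zero (subB σ bb) ≡ WB zero bb
  WB0-subB-unused σ i h (body c)    e = refl
  WB0-subB-unused σ i h (door d bb) e =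
    cong₂ _+_ (W0-subA-unused σ i h d (m+n≡0⇒m≡0 _ e))
              (WB0-subB-unused (extsA σ) (suc i) (extsA-RenamingExcept h) bb (m+n≡0⇒n≡0 _ e))

m+n≤1⇒m≡0⊎n≡0 : ∀ a b → a + b ≤ 1 → (a ≡ 0) ⊎ (b ≡ 0)
m+n≤1⇒m≡0⊎n≡0 zero    b       _ = inj₁ refl
m+n≤1⇒m≡0⊎n≡0 (suc a) zero    _ = inj₂ refl
m+n≤1⇒m≡0⊎n≡0 (suc a) (suc b) (s≤s p) = ⊥-elim (1+n≰0 (≤-trans (≤-reflexive (sym (+-suc a b))) p))
  where
  1+n≰0 : ∀ {k} → ¬ suc k ≤ 0
  1+n≰0 ()

mutual
  W0-subA-linear : ∀ {n m} (σ : Fin n → ATm m) i → RenamingExcept σ i → ∀ t → occ0 i t ≤ 1 →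
                   W zero (subA σ t) ≤ W zero t * W zero (σ i)
  W0-subA-linear σ i h (rvar y) p with y Fin.≟ i
  ... | yes refl = ≤-reflexive (sym (+-identityʳ _))
  ... | no y≢i with h y y≢i
  ...   | w , σy≡w rewrite σy≡w = ≤-trans (W0-pos (σ i)) (≤-reflexive (sym (+-identityʳ _)))
  W0-subA-linear σ i h rF p = ≤-trans (W0-pos (σ i)) (≤-reflexive (sym (+-identityʳ _)))
  W0-subA-linear σ i h rT p = ≤-trans (W0-pos (σ i)) (≤-reflexive (sym (+-identityʳ _)))
  W0-subA-linear σ i h (lamL t) p =
    +-mono-≤ (W0-pos (σ i)) (≤-trans (W0-subA-linear (extsA σ) (suc i) (extsA-RenamingExcept h) t p)
                                     (≤-reflexive (cong (W zero t *_) (W-renA suc zero (σ i)))))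
  W0-subA-linear σ i h (lamN t) p =
    +-mono-≤ (W0-pos (σ i)) (≤-trans (W0-subA-linear (extsA σ) (suc i) (extsA-RenamingExcept h) t p)
                                     (≤-reflexive (cong (W zero t *_) (W-renA suc zero (σ i)))))
  W0-subA-linear σ i h (appL t u) p with m+n≤1⇒m≡0⊎n≡0 (occ0 i t) (occ0 i u) p
  ... | inj₁ e = +-mono-≤ (W0-pos (σ i))
                   (≤-trans (≤-reflexive (cong (_* W zero (subA σ u)) (W0-subA-unused σ i h t e)))
                   (≤-trans (*-monoʳ-≤ (W zero t) (W0-subA-linear σ i h u (≤-trans (m≤n+m _ _) p)))
                            (≤-reflexive (sym (*-assoc (W zero t) (W zero u) _)))))
  ... | inj₂ e = +-mono-≤ (W0-pos (σ i))
                   (≤-trans (≤-reflexive (cong (W zero (subA σ t) *_) (W0-subA-unused σ i h u e)))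
                   (≤-trans (*-monoˡ-≤ (W zero u) (W0-subA-linear σ i h t (≤-trans (m≤m+n _ _) p)))
                            (≤-reflexive (*-right-comm (W zero t) (W zero (σ i)) (W zero u)))))
    where
    *-right-comm : ∀ a w b → a * w * b ≡ a * b * w
    *-right-comm a w b = trans (*-assoc a w b) (trans (cong (a *_) (*-comm w b)) (sym (*-assoc a b w)))
  W0-subA-linear σ i h (appN t u) p = +-mono-≤ (W0-pos (σ i)) (W0-subA-linear σ i h t p)
  W0-subA-linear σ i h (rite c a b) p =
    +-mono-≤ (W0-pos (σ i))
      (≤-trans (+-mono-≤ (W0-subA-linear σ i h c p-c) (+-mono-≤ (W0-subA-linear σ i h a p-a) (W0-subA-linear σ i h b p-b)))
               (≤-reflexive (trans (cong (W zero c * W zero (σ i) +_) (sym (*-distribʳ-+ (W zero (σ i)) (W zero a) (W zero b))))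
                                   (sym (*-distribʳ-+ (W zero (σ i)) (W zero c) _)))))
    where
    p-c : occ0 i c ≤ 1
    p-c = ≤-trans (m≤m⊔n _ _) p
    p-ab : occ0 i a ⊔ occ0 i b ≤ 1
    p-ab = ≤-trans (m≤n⊔m (occ0 i c) _) p
    p-a : occ0 i a ≤ 1
    p-a = ≤-trans (m≤m⊔n _ _) p-ab
    p-b : occ0 i b ≤ 1
    p-b = ≤-trans (m≤n⊔m (occ0 i a) _) p-ab
  W0-subA-linear σ i h (box bb) p = +-mono-≤ (W0-pos (σ i)) (+-mono-≤ (W0-pos (σ i)) (WB0-subB-linear σ i h bb p))

  WB0-subB-linear : ∀ {n m} (σ : Fin n → ATm m) i → RenamingExcept σ i → ∀ bb → occB0 i bb ≤ 1 →
                    WB zero (subB σ bb) ≤ WB zero bb * W zero (σ i)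
  WB0-subB-linear σ i h (body c)    p = z≤n
  WB0-subB-linear σ i h (door d bb) p =
    ≤-trans (+-mono-≤ (W0-subA-linear σ i h d (≤-trans (m≤m+n _ _) p))
                      (≤-trans (WB0-subB-linear (extsA σ) (suc i) (extsA-RenamingExcept h) bb (≤-trans (m≤n+m _ _) p))
                               (≤-reflexive (cong (WB zero bb *_) (W-renA suc zero (σ i))))))
            (≤-reflexive (sym (*-distribʳ-+ (W zero (σ i)) (W zero d) (WB zero bb))))

WB0-mergeB : ∀ {n} (bb' : ABox n) (bb : ABox (suc n)) → occB0 zero bb ≡ 0 →
             WB zero (mergeB bb' bb) ≡ WB zero bb' + WB zero bb
WB0-mergeB (body s) bb e = WB0-subB-unused (singleA s) zero (singleA-RenamingExcept s) bb e
WB0-mergeB (door d bb') bb e =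
  trans (cong (W zero d +_) (trans (WB0-mergeB bb' (renB (ext suc) bb) (trans (occB0-zero-renB-ext suc bb) e))
                                   (cong (WB zero bb' +_) (WB-renB (ext suc) zero bb))))
        (sym (+-assoc (W zero d) _ _))

data Lex : ℕ → (ℕ → ℕ) → (ℕ → ℕ) → Set where
  lex-head : ∀ {L f g} → f 0 < g 0 → Lex L f g
  lex-tail : ∀ {L f g} → f 0 ≡ g 0 → Lex L (λ d → f (suc d)) (λ d → g (suc d)) → Lex (suc L) f g

acc-lex-zero : ∀ {a f} → Acc _<_ a → f 0 ≡ a → Acc (Lex zero) f
acc-lex-zero (acc rs) f0≡a = acc λ { (lex-head lt) → acc-lex-zero (rs (transport (_ <_) f0≡a lt)) refl }

mutual
  acc-lex-suc : ∀ {L} → WellFounded (Lex L) → ∀ {a f} → Acc _<_ a → f 0 ≡ a →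
                Acc (Lex L) (λ d → f (suc d)) → Acc (Lex (suc L)) f
  acc-lex-suc wf a-acc f0≡a tail-acc = acc (acc-lex-suc-below wf a-acc f0≡a tail-acc)

  acc-lex-suc-below : ∀ {L} → WellFounded (Lex L) → ∀ {a f} → Acc _<_ a → f 0 ≡ a →
                      Acc (Lex L) (λ d → f (suc d)) → ∀ {g} → Lex (suc L) g f → Acc (Lex (suc L)) g
  acc-lex-suc-below wf (acc rs) f0≡a _        (lex-head lt)   = acc-lex-suc wf (rs (transport (_ <_) f0≡a lt)) refl (wf _)
  acc-lex-suc-below wf a-acc    f0≡a (acc rt) (lex-tail e lt) = acc-lex-suc wf a-acc (trans e f0≡a) (rt lt)

lex-wellFounded : ∀ L → WellFounded (Lex L)
lex-wellFounded zero    f = acc-lex-zero (<-wellFounded (f 0)) refl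
lex-wellFounded (suc L) f =
  acc-lex-suc (lex-wellFounded L) (<-wellFounded (f 0)) refl (lex-wellFounded L (λ d → f (suc d)))

lex-resp : ∀ {L} {f f' g g' : ℕ → ℕ} → (∀ d → f d ≡ f' d) → (∀ d → g d ≡ g' d) → Lex L f g → Lex L f' g'
lex-resp hf hg (lex-head lt)   = lex-head (subst₂ _<_ (hf 0) (hg 0) lt)
lex-resp hf hg (lex-tail e lt) =
  lex-tail (trans (sym (hf 0)) (trans e (hg 0))) (lex-resp (λ d → hf (suc d)) (λ d → hg (suc d)) lt)

StrictlyMonotone : (ℕ → ℕ → ℕ) → Set
StrictlyMonotone φ = ∀ d {x y} → x < y → φ d x < φ d y

-- Applying a strictly monotone map at each depth preserves the order; this
-- is the shape of every congruence step.
lex-map : ∀ {L f g} (φ : ℕ → ℕ → ℕ) → StrictlyMonotone φ → Lex L f g →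
          Lex L (λ d → φ d (f d)) (λ d → φ d (g d))
lex-map φ mono (lex-head lt)   = lex-head (mono 0 lt)
lex-map φ mono (lex-tail e lt) = lex-tail (cong (φ 0) e) (lex-map (λ d → φ (suc d)) (λ d → mono (suc d)) lt)

lex-congruence : ∀ {L f g F G} (φ : ℕ → ℕ → ℕ) → StrictlyMonotone φ →
                 (∀ d → φ d (f d) ≡ F d) → (∀ d → φ d (g d) ≡ G d) → Lex L f g → Lex L F G
lex-congruence φ mono hf hg lt = lex-resp hf hg (lex-map φ mono lt)

by-depth : ∀ {F G : ℕ → ℕ} → F 0 ≡ G 0 → (∀ d → F (suc d) ≡ G (suc d)) → ∀ d → F d ≡ G d
by-depth h₀ hₛ zero    = h₀
by-depth h₀ hₛ (suc d) = hₛ d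

deeper : ℕ → (ℕ → ℕ) → ℕ → ℕ
deeper a f zero    = a
deeper a f (suc d) = f d

lex-deeper : ∀ {L} a {f g} → Lex L f g → Lex (suc L) (deeper a f) (deeper a g)
lex-deeper a lt = lex-tail refl lt

μ : ∀ {n} → ATm n → ℕ → ℕ
μ r d = W d r

μB : ∀ {n} → ABox n → ℕ → ℕ
μB bb d = WB d bb

tick : ℕ → ℕ → ℕ
tick zero    x = suc x
tick (suc d) x = x

tick-mono : StrictlyMonotone tick
tick-mono zero    lt = s≤s lt
tick-mono (suc d) lt = lt


-- The redexes are strictly lighter at depth 0 after contraction.  A linear
-- β-step copies its argument at most once at depth 0.
βL-decreases : ∀ {n} (t : ATm (suc n)) u → occ zero t ≤ 1 → W zero (t [ u ]ᴬ) < W zero (appL (lamL t) u)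
βL-decreases t u p =
  s≤s (≤-trans (W0-subA-linear (singleA u) zero (singleA-RenamingExcept u) t (≤-trans (occ0≤occ zero t) p))
               (m≤n+m _ (W zero u)))

-- A non-linear β-step removes a node without copying anything at depth 0.
βN-decreases : ∀ {n L} {E : Env n} {t : ATm (suc n)} {u A B} → L ∣ dnl A ∷ₑ E ⊩ t ∶ B →
               W zero (t [ u ]ᴬ) < W zero (appN (lamN t) u)
βN-decreases {t = t} {u} d =
  s≤s (≤-trans (≤-reflexive (W0-subA-unused (singleA u) zero (singleA-RenamingExcept u) t (notAtDepth0-occ0 zero d tt)))
               (n≤1+n _))

-- Merging removes the box node of a door at depth 0.
mergeB-decreases : ∀ {n L} {Eo : Env n} {Ei : Env (suc n)} (bb' : ABox n) {bb A} → BTy L (dnone ∷ₑ Eo) Ei bb A →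
                   WB zero (mergeB bb' bb) < WB zero (door (box bb') bb)
mergeB-decreases bb' {bb} b =
  ≤-trans (s≤s (≤-reflexive (WB0-mergeB bb' bb (notAtDepth0-occB0 zero b tt)))) (n≤1+n _)

mutual
  decrease : ∀ {n L} {E : Env n} {r r' A} → L ∣ E ⊩ r ∶ A → r ↝ r' → Lex L (μ r') (μ r)
  decrease (t∀ f) s = decrease (f 𝔹) s
  decrease (tappL (tlamL {t = t} p d₁) d₂ g) (βL {u = u}) = lex-head (βL-decreases t u p)
  decrease (tappN (tlamN d₁) d₂ g)   βN = lex-head (βN-decreases d₁)
  decrease (tite k d₀ d₁ d₂) (δT' {c} {a} {b} e) =
    lex-head (s≤s (≤-trans (m≤m+n (W zero a) (W zero b)) (m≤n+m _ (W zero c))))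
  decrease (tite k d₀ d₁ d₂) (δF' {c} {a} {b} e) =
    lex-head (s≤s (≤-trans (m≤n+m (W zero b) (W zero a)) (m≤n+m _ (W zero c))))
  decrease (tappL d₁ d₂ g) (ξappLl {u = u} s) =
    lex-congruence (λ { zero x → suc (x * W zero u) ; (suc d) x → x + W (suc d) u })
                   (λ { zero lt → s≤s (*-monoˡ-< (W zero u) {{>-nonZero (W0-pos u)}} lt) ; (suc d) lt → +-monoˡ-< _ lt })
                   (by-depth refl λ _ → refl) (by-depth refl λ _ → refl) (decrease d₁ s)
  decrease (tappL d₁ d₂ g) (ξappLr {t} s) =
    lex-congruence (λ { zero x → suc (W zero t * x) ; (suc d) x → W (suc d) t + x })
                   (λ { zero lt → s≤s (*-monoʳ-< (W zero t) {{>-nonZero (W0-pos t)}} lt) ; (suc d) lt → +-monoʳ-< _ lt })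
                   (by-depth refl λ _ → refl) (by-depth refl λ _ → refl) (decrease d₂ s)
  decrease (tappN d₁ d₂ g) (ξappNl {u = u} s) =
    lex-congruence (λ { zero x → suc x ; (suc d) x → x + W d u })
                   (λ { zero lt → s≤s lt ; (suc d) lt → +-monoˡ-< _ lt })
                   (by-depth refl λ _ → refl) (by-depth refl λ _ → refl) (decrease d₁ s)
  decrease (tappN d₁ d₂ g) (ξappNr {t} s) =
    lex-congruence (λ { zero x → x ; (suc d) x → W (suc d) t + x })
                   (λ { zero lt → lt ; (suc d) lt → +-monoʳ-< _ lt })
                   (by-depth refl λ _ → refl) (by-depth refl λ _ → refl)
                   (lex-deeper (suc (W zero t)) (decrease d₂ s))
  decrease (tite k d₀ d₁ d₂) (ξrite₀ {a = a} {b} s) =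
    lex-congruence (λ d x → tick d (x + (W d a + W d b)))
                   (λ d lt → tick-mono d (+-monoˡ-< (W d a + W d b) lt))
                   (by-depth refl λ _ → refl) (by-depth refl λ _ → refl) (decrease d₀ s)
  decrease (tite k d₀ d₁ d₂) (ξrite₁ {c} {b = b} s) =
    lex-congruence (λ d x → tick d (W d c + (x + W d b)))
                   (λ d lt → tick-mono d (+-monoʳ-< (W d c) (+-monoˡ-< (W d b) lt)))
                   (by-depth refl λ _ → refl) (by-depth refl λ _ → refl) (decrease d₁ s)
  decrease (tite k d₀ d₁ d₂) (ξrite₂ {c} {a} s) =
    lex-congruence (λ d x → tick d (W d c + (W d a + x)))
                   (λ d lt → tick-mono d (+-monoʳ-< (W d c) (+-monoʳ-< (W d a) lt)))
                   (by-depth refl λ _ → refl) (by-depth refl λ _ → refl) (decrease d₂ s)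
  decrease (tlamL p d) (ξlamL s) =
    lex-congruence tick tick-mono
                   (by-depth refl λ _ → refl) (by-depth refl λ _ → refl) (decrease d s)
  decrease (tlamN d) (ξlamN s) =
    lex-congruence tick tick-mono
                   (by-depth refl λ _ → refl) (by-depth refl λ _ → refl) (decrease d s)
  decrease (tbox b) (ξbox s) =
    lex-congruence (λ d x → tick d (tick d x)) (λ d {x} {y} lt → tick-mono d {tick d x} {tick d y} (tick-mono d lt))
                   (by-depth refl λ _ → refl) (by-depth refl λ _ → refl) (decreaseB b s)

  decreaseB : ∀ {n L} {Eo Ei : Env n} {bb bb' A} → BTy L Eo Ei bb A → bb ↝B bb' → Lex (suc L) (μB bb') (μB bb)
  decreaseB (tdoor d p b) (merge {bb'}) = lex-head (mergeB-decreases bb' b)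
  decreaseB (tbody d)     (ξbody s) =
    lex-resp (by-depth refl λ _ → refl) (by-depth refl λ _ → refl) (lex-deeper 0 (decrease d s))
  decreaseB (tdoor d p b) (ξdoorl {bb = bb} s) =
    lex-congruence (λ d x → x + WB d bb) (λ d lt → +-monoˡ-< _ lt)
                   (by-depth refl λ _ → refl) (by-depth refl λ _ → refl) (decrease d s)
  decreaseB (tdoor {d = e} d p b) (ξdoorr s) =
    lex-congruence (λ d x → W d e + x) (λ d lt → +-monoʳ-< _ lt)
                   (by-depth refl λ _ → refl) (by-depth refl λ _ → refl) (decreaseB b s)

canonical-⊸ : ∀ {n L} {E : Env n} {t A D} → L ∣ E ⊩ t ∶ A ⊸ D →
              (Σ (ATm (suc n)) λ t₀ → t ≡ lamL t₀) ⊎ NotLam (erase t)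
canonical-⊸ (tvar _ _)     = inj₂ tt
canonical-⊸ (tlamL _ _)    = inj₁ (_ , refl)
canonical-⊸ (tappL _ _ _)  = inj₂ tt
canonical-⊸ (tappN _ _ _)  = inj₂ tt
canonical-⊸ (tite _ _ _ _) = inj₂ tt

canonical-⇒ : ∀ {n L} {E : Env n} {t A D} → L ∣ E ⊩ t ∶ A ⇒ D →
              (Σ (ATm (suc n)) λ t₀ → t ≡ lamN t₀) ⊎ NotLam (erase t)
canonical-⇒ (tvar _ _)     = inj₂ tt
canonical-⇒ (tlamN _)      = inj₁ (_ , refl)
canonical-⇒ (tappL _ _ _)  = inj₂ tt
canonical-⇒ (tappN _ _ _)  = inj₂ tt
canonical-⇒ (tite _ _ _ _) = inj₂ tt

canonical-§ : ∀ {n L} {E : Env n} {t B} → L ∣ E ⊩ t ∶ § B →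
              (Σ (ABox n) λ bb → t ≡ box bb) ⊎ (NotLam (erase t) × NotBool (erase t))
canonical-§ (tvar _ _)     = inj₂ (tt , tt)
canonical-§ (tappL _ _ _)  = inj₂ (tt , tt)
canonical-§ (tappN _ _ _)  = inj₂ (tt , tt)
canonical-§ (tite _ _ _ _) = inj₂ (tt , tt)
canonical-§ (tbox _)       = inj₁ (_ , refl)

boolean? : ∀ {n} (t : Tm n) → (t ≡ Tr) ⊎ ((t ≡ Fl) ⊎ NotBool t)
boolean? (var x)     = inj₂ (inj₂ tt)
boolean? Fl          = inj₂ (inj₁ refl)
boolean? Tr          = inj₁ refl
boolean? (lam t)     = inj₂ (inj₂ tt)
boolean? (app t u)   = inj₂ (inj₂ tt)
boolean? (ite t u v) = inj₂ (inj₂ tt)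

mutual
  progress : ∀ {n L} {E : Env n} {r A} → L ∣ E ⊩ r ∶ A → (Σ (ATm n) λ r' → r ↝ r') ⊎ Nf (erase r)
  progress (t∀ f)     = progress (f 𝔹)
  progress (tvar u g) = inj₂ nvar
  progress tF         = inj₂ nF
  progress tT         = inj₂ nT
  progress (tlamL p d) with progress d
  ... | inj₁ (_ , s) = inj₁ (_ , ξlamL s)
  ... | inj₂ nf      = inj₂ (nlam nf)
  progress (tlamN d) with progress d
  ... | inj₁ (_ , s) = inj₁ (_ , ξlamN s)
  ... | inj₂ nf      = inj₂ (nlam nf)
  progress (tappL d₁ d₂ g) with progress d₁ | progress d₂ | canonical-⊸ d₁
  ... | inj₁ (_ , s) | _            | _              = inj₁ (_ , ξappLl s)
  ... | inj₂ _       | inj₁ (_ , s) | _              = inj₁ (_ , ξappLr s)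
  ... | inj₂ _       | inj₂ _       | inj₁ (_ , refl) = inj₁ (_ , βL)
  ... | inj₂ n₁      | inj₂ n₂      | inj₂ ¬lam      = inj₂ (napp n₁ n₂ ¬lam)
  progress (tappN d₁ d₂ g) with progress d₁ | progress d₂ | canonical-⇒ d₁
  ... | inj₁ (_ , s) | _            | _              = inj₁ (_ , ξappNl s)
  ... | inj₂ _       | inj₁ (_ , s) | _              = inj₁ (_ , ξappNr s)
  ... | inj₂ _       | inj₂ _       | inj₁ (_ , refl) = inj₁ (_ , βN)
  ... | inj₂ n₁      | inj₂ n₂      | inj₂ ¬lam      = inj₂ (napp n₁ n₂ ¬lam)
  progress (tite {c = c} k d₀ d₁ d₂) with progress d₀ | progress d₁ | progress d₂ | boolean? (erase c)
  ... | inj₁ (_ , s) | _            | _            | _               = inj₁ (_ , ξrite₀ s)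
  ... | inj₂ _       | inj₁ (_ , s) | _            | _               = inj₁ (_ , ξrite₁ s)
  ... | inj₂ _       | inj₂ _       | inj₁ (_ , s) | _               = inj₁ (_ , ξrite₂ s)
  ... | inj₂ _       | inj₂ _       | inj₂ _       | inj₁ e          = inj₁ (_ , δT' e)
  ... | inj₂ _       | inj₂ _       | inj₂ _       | inj₂ (inj₁ e)   = inj₁ (_ , δF' e)
  ... | inj₂ n₀      | inj₂ n₁      | inj₂ n₂      | inj₂ (inj₂ ¬b)  = inj₂ (nite n₀ n₁ n₂ ¬b)
  progress (tbox b) with progressB b
  ... | inj₁ (_ , s) = inj₁ (_ , ξbox s)
  ... | inj₂ nf      = inj₂ nf

  progressB : ∀ {n L} {Eo Ei : Env n} {bb A} → BTy L Eo Ei bb A → (Σ (ABox n) λ bb' → bb ↝B bb') ⊎ Nf (eraseB bb)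
  progressB (tbody d) with progress d
  ... | inj₁ (_ , s) = inj₁ (_ , ξbody s)
  ... | inj₂ nf      = inj₂ nf
  progressB (tdoor d p b) with progress d | progressB b | canonical-§ d
  ... | inj₁ (_ , s) | _            | _                 = inj₁ (_ , ξdoorl s)
  ... | inj₂ _       | inj₁ (_ , s) | _                 = inj₁ (_ , ξdoorr s)
  ... | inj₂ _       | inj₂ _       | inj₁ (_ , refl)   = inj₁ (_ , merge)
  ... | inj₂ n₁      | inj₂ n₂      | inj₂ (¬lam , ¬b)  = inj₂ ([]-Nf n₂ (n₁ , ¬lam , ¬b))

normalise-acc : ∀ {n L} {E : Env n} {A} (r : ATm n) → Acc (Lex L) (μ r) → L ∣ E ⊩ r ∶ A →
                Σ (ATm n) λ r' → (erase r ⟶* erase r') × Nf (erase r')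
normalise-acc r (acc rs) d with progress d
... | inj₂ nf = r , ε , nf
... | inj₁ (r' , s) with normalise-acc r' (rs (decrease d s)) (preservation d s)
...   | r'' , ss , nf = r'' , (erase-↝ s ◅◅ ss) , nf

annotated-normalising : ∀ {n L} {E : Env n} {A} (r : ATm n) → L ∣ E ⊩ r ∶ A →
                        Σ (Tm n) λ u → (erase r ⟶* u) × Normal u
annotated-normalising {L = L} r d with normalise-acc r (lex-wellFounded L (μ r)) d
... | r' , ss , nf = erase r' , ss , Nf⇒Normal nf

mutual
  raise-budget : ∀ {n L L'} {E : Env n} {r A} → L ≤ L' → L ∣ E ⊩ r ∶ A → L' ∣ E ⊩ r ∶ A
  raise-budget p       (tvar u g)        = tvar u g
  raise-budget p       tF                = tF
  raise-budget p       tT                = tT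
  raise-budget p       (tlamL q d)       = tlamL q (raise-budget p d)
  raise-budget p       (tlamN d)         = tlamN (raise-budget p d)
  raise-budget p       (tappL d₁ d₂ g)   = tappL (raise-budget p d₁) (raise-budget p d₂) g
  raise-budget (s≤s p) (tappN d₁ d₂ g)   = tappN (raise-budget (s≤s p) d₁) (raise-budget p d₂) g
  raise-budget p       (tite k d₀ d₁ d₂) = tite k (raise-budget p d₀) (raise-budget p d₁) (raise-budget p d₂)
  raise-budget (s≤s p) (tbox b)          = tbox (raise-budgetB p b)
  raise-budget p       (t∀ f)            = t∀ (λ B → raise-budget p (f B))

  raise-budgetB : ∀ {n L L'} {Eo Ei : Env n} {bb A} → L ≤ L' → BTy L Eo Ei bb A → BTy L' Eo Ei bb A
  raise-budgetB p (tbody d)     = tbody (raise-budget p d)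
  raise-budgetB p (tdoor d q b) = tdoor (raise-budget (s≤s p) d) q (raise-budgetB p b)

substEntry : ℕ → Ty → Entry → Entry
substEntry j B dnone    = dnone
substEntry j B (dlin A) = dlin (substTy j B A)
substEntry j B (dnl A)  = dnl (substTy j B A)
substEntry j B (dshr A) = dshr (substTy j B A)

usable-substTy : ∀ j B {s A} → Usable s A → Usable (substEntry j B s) (substTy j B A)
usable-substTy j B ulin = ulin
usable-substTy j B ushr = ushr

substEntry-hide : ∀ j B s → substEntry j B (hideS s) ≡ hideS (substEntry j B s)
substEntry-hide j B dnone    = refl
substEntry-hide j B (dlin _) = refl
substEntry-hide j B (dnl _)  = refl
substEntry-hide j B (dshr _) = refl

≥-substTy : ∀ j B {A T} → A ≥ T → substTy j B A ≥ substTy j B T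
≥-substTy j B ≥refl                 = ≥refl
≥-substTy j B {⋀ A} (≥inst B' p) =
  ≥inst (substTy j B B') (transport (_≥ _) (substTy-substTy 0 j z≤n B B' A) (≥-substTy j B p))

mutual
  substTy-⊩ : ∀ {n L} {E : Env n} {r A} j B → L ∣ E ⊩ r ∶ A → L ∣ (λ x → substEntry j B (E x)) ⊩ r ∶ substTy j B A
  substTy-⊩ j B (tvar u g)      = tvar (usable-substTy j B u) (≥-substTy j B g)
  substTy-⊩ j B tF              = tF
  substTy-⊩ j B tT              = tT
  substTy-⊩ j B (tlamL p d)     = tlamL p (env-cong (λ { zero → refl ; (suc x) → refl }) (substTy-⊩ j B d))
  substTy-⊩ j B (tlamN d)       = tlamN (env-cong (λ { zero → refl ; (suc x) → refl }) (substTy-⊩ j B d))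
  substTy-⊩ j B (tappL d₁ d₂ g) = tappL (substTy-⊩ j B d₁) (substTy-⊩ j B d₂) (≥-substTy j B g)
  substTy-⊩ {E = E} j B (tappN d₁ d₂ g) =
    tappN (substTy-⊩ j B d₁) (env-cong (λ x → substEntry-hide j B (E x)) (substTy-⊩ j B d₂)) (≥-substTy j B g)
  substTy-⊩ j B (tite k d₀ d₁ d₂) =
    tite k (transport (λ T → _ ∣ _ ⊩ _ ∶ T) (substTy-§^𝔹 j B k) (substTy-⊩ j B d₀))
           (substTy-⊩ j B d₁) (substTy-⊩ j B d₂)
  substTy-⊩ {E = E} j B (tbox b) =
    tbox (weakenB (λ x → ≼refl) (λ x → ≡⇒≼ (substEntry-hide j B (E x))) (substTyB-⊩ j B b))
  substTy-⊩ {L = L} {E = E} {r = r} j B (t∀ {A = A} f) =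
    t∀ (λ B' → transport (λ T → L ∣ (λ x → substEntry j B (E x)) ⊩ r ∶ T) (substTy-instance j B A B')
                         (substTy-⊩ j B (f (shiftTy j B'))))

  substTyB-⊩ : ∀ {n L} {Eo Ei : Env n} {bb A} j B → BTy L Eo Ei bb A →
               BTy L (λ x → substEntry j B (Eo x)) (λ x → substEntry j B (Ei x)) bb (substTy j B A)
  substTyB-⊩ j B (tbody d)     = tbody (substTy-⊩ j B d)
  substTyB-⊩ j B (tdoor d p b) =
    tdoor (substTy-⊩ j B d) p
          (weakenB (λ { zero → ≼refl ; (suc x) → ≼refl }) (λ { zero → ≼refl ; (suc x) → ≼refl }) (substTyB-⊩ j B b))

entryOf : Slot → Entry
entryOf ∅       = dnone
entryOf (lin A) = dlin A
entryOf (nl A)  = dnl A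

envOf : ∀ {n} → Ctx n → Env n
envOf C x = entryOf (lookup C x)

Merge-lookup : ∀ {n} {C₁ C₂ C : Ctx n} → Merge C₁ C₂ C → ∀ x →
               ((lookup C₁ x ≡ lookup C x) × (lookup C₂ x ≡ ∅)) ⊎ ((lookup C₁ x ≡ ∅) × (lookup C₂ x ≡ lookup C x))
Merge-lookup (left ∷ m)  zero    = inj₁ (refl , refl)
Merge-lookup (right ∷ m) zero    = inj₂ (refl , refl)
Merge-lookup (_ ∷ m)     (suc x) = Merge-lookup m x

Sub-lookup : ∀ {n} {C C' : Ctx n} → Sub C C' → ∀ x → (lookup C x ≡ ∅) ⊎ (lookup C x ≡ lookup C' x)
Sub-lookup (absent ∷ s) zero    = inj₁ refl
Sub-lookup (same ∷ s)   zero    = inj₂ refl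
Sub-lookup (_ ∷ s)      (suc x) = Sub-lookup s x

Par-lookup : ∀ {n} {C C' : Ctx n} → Par C C' → ∀ x → ParS (lookup C x) (lookup C' x)
Par-lookup (p ∷ ps) zero    = p
Par-lookup (_ ∷ ps) (suc x) = Par-lookup ps x

absent-≼ : ∀ {s} t → s ≡ ∅ → entryOf s ≼ t
absent-≼ t refl = ≼none

Merge-≼ˡ : ∀ {n} {C₁ C₂ C : Ctx n} → Merge C₁ C₂ C → ∀ x → envOf C₁ x ≼ envOf C x
Merge-≼ˡ m x with Merge-lookup m x
... | inj₁ (e , _) = ≡⇒≼ (cong entryOf e)
... | inj₂ (e , _) = absent-≼ _ e

Merge-≼ʳ : ∀ {n} {C₁ C₂ C : Ctx n} → Merge C₁ C₂ C → ∀ x → envOf C₂ x ≼ envOf C x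
Merge-≼ʳ m x with Merge-lookup m x
... | inj₁ (_ , e) = absent-≼ _ e
... | inj₂ (_ , e) = ≡⇒≼ (cong entryOf e)

Linear : ∀ {n} → Ctx n → ATm n → Set
Linear {n} C r = ∀ (x : Fin n) A → lookup C x ≡ lin A → occ x r ≤ 1

-- Boxing: the translation of the rule (§i).

moveToFront : ∀ {n} → Fin n → Fin n → Fin (suc n)
moveToFront x y with y Fin.≟ x
... | yes _ = zero
... | no _  = suc y

moveToFront-here : ∀ {n} (x : Fin n) → moveToFront x x ≡ zero
moveToFront-here x with x Fin.≟ x
... | yes _  = refl
... | no x≢x = ⊥-elim (x≢x refl)

moveToFront-there : ∀ {n} {x y : Fin n} → ¬ y ≡ x → moveToFront x y ≡ suc y
moveToFront-there {x = x} {y} y≢x with y Fin.≟ x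
... | yes y≡x = ⊥-elim (y≢x y≡x)
... | no _    = refl

moveToFront-injectiveAt-here : ∀ {n} (x : Fin n) → InjectiveAt (moveToFront x) x
moveToFront-injectiveAt-here x z e with z Fin.≟ x
... | yes z≡x = z≡x
... | no _    with () ← trans e (moveToFront-here x)

moveToFront-injectiveAt-there : ∀ {n} {x y : Fin n} → ¬ y ≡ x → InjectiveAt (moveToFront x) y
moveToFront-injectiveAt-there {x = x} y≢x z e with z Fin.≟ x
... | yes _ with () ← trans e (moveToFront-there y≢x)
... | no _  = Fin.suc-injective (trans e (moveToFront-there y≢x))

moveToFront-misses : ∀ {n} (x : Fin n) → Misses (moveToFront x) (suc x)
moveToFront-misses x z e with z Fin.≟ x
... | yes _   with () ← e
... | no z≢x  = z≢x (Fin.suc-injective e)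

erase-moveToFront : ∀ {n} (x : Fin n) (t : Tm n) → rename (moveToFront x) t [ var x ] ≡ t
erase-moveToFront x t =
  trans ([]-as-subst (rename (moveToFront x) t) (var x))
        (trans (subst-rename (single (var x)) (moveToFront x) t) (trans (subst-cong back t) (subst-var t)))
  where
  back : ∀ y → single (var x) (moveToFront x y) ≡ var y
  back y with y Fin.≟ x
  ... | yes refl = refl
  ... | no _     = refl

frontEnv : ∀ {n} → Fin n → Entry → Env n → Env (suc n)
frontEnv x s E zero    = s
frontEnv x s E (suc y) with y Fin.≟ x
... | yes _ = dnone
... | no _  = E y

frontEnv-there : ∀ {n} {x y : Fin n} s E → ¬ y ≡ x → frontEnv x s E (suc y) ≡ E y
frontEnv-there {x = x} {y} s E y≢x with y Fin.≟ x
... | yes y≡x = ⊥-elim (y≢x y≡x)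
... | no _    = refl

moveToFront-≼ : ∀ {n} (x : Fin n) {s} (E : Env n) → E x ≡ s → ∀ y → E y ≼ frontEnv x s E (moveToFront x y)
moveToFront-≼ x {s} E Ex≡s y = by-cases (y Fin.≟ x)
  where
  by-cases : Dec (y ≡ x) → E y ≼ frontEnv x s E (moveToFront x y)
  by-cases (yes refl) = transport (λ z → E y ≼ frontEnv y s E z) (sym (moveToFront-here y)) (≡⇒≼ Ex≡s)
  by-cases (no y≢x)   = transport (λ z → E y ≼ frontEnv x s E z) (sym (moveToFront-there y≢x))
                                  (≡⇒≼ (sym (frontEnv-there s E y≢x)))

-- The status of a variable with respect to a box: its entries outside (o),
-- inside (i) and in the body to be boxed (c).  Either the body's entry is
-- already admissible inside, or the variable is pending: linear of type §B
-- outside, absent inside, linear of type B in the body — it must be bound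
-- by a door.
BoxStatus : Entry → Entry → Entry → Set
BoxStatus o i c = (c ≼ i) ⊎ (Σ Ty λ B → (o ≡ dlin (§ B)) × (i ≡ dnone) × (c ≡ dlin B))

Pending : ∀ {o i c} → BoxStatus o i c → Set
Pending (inj₁ _) = ⊥
Pending (inj₂ _) = ⊤

-- The bound on the occurrences in the box, given those in the body: a
-- pending variable ends up as exactly one door.
occBound : ∀ {o i c} → BoxStatus o i c → ℕ → ℕ
occBound (inj₁ _) k = k
occBound (inj₂ _) k = 1

frontStatus : ∀ {n} (x : Fin n) {Eo Ei Ec : Env n} {B} → (∀ y → BoxStatus (Eo y) (Ei y) (Ec y)) →
              ∀ y → BoxStatus ((dnone ∷ₑ Eo) y) ((dlin B ∷ₑ Ei) y) (frontEnv x (dlin B) Ec y)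
frontStatus x P zero    = inj₁ ≼refl
frontStatus x P (suc y) with y Fin.≟ x
... | yes _ = inj₁ ≼none
... | no _  = P y

frontStatus-pending : ∀ {n} (x : Fin n) {Eo Ei Ec : Env n} {B} (P : ∀ y → BoxStatus (Eo y) (Ei y) (Ec y)) y →
                      Pending (frontStatus x {B = B} P (suc y)) → (¬ y ≡ x) × Pending (P y)
frontStatus-pending x P y pending with y Fin.≟ x
... | no y≢x = y≢x , pending

frontStatus-occBound-here : ∀ {n} (x : Fin n) {Eo Ei Ec : Env n} {B} (P : ∀ y → BoxStatus (Eo y) (Ei y) (Ec y)) k →
                            occBound (frontStatus x {B = B} P (suc x)) k ≡ k
frontStatus-occBound-here x P k with x Fin.≟ x
... | yes _  = refl
... | no x≢x = ⊥-elim (x≢x refl)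

frontStatus-occBound-there : ∀ {n} (x : Fin n) {Eo Ei Ec : Env n} {B} (P : ∀ y → BoxStatus (Eo y) (Ei y) (Ec y)) {y} k →
                             ¬ y ≡ x → occBound (frontStatus x {B = B} P (suc y)) k ≡ occBound (P y) k
frontStatus-occBound-there x P {y} k y≢x with y Fin.≟ x
... | yes y≡x = ⊥-elim (y≢x y≡x)
... | no _    = refl

record Boxing {n} (L : ℕ) (Eo Ei : Env n) (A : Ty) (c : ATm n) (bound : Fin n → ℕ) : Set where
  field
    boxed   : ABox n
    typed   : BTy L Eo Ei boxed A
    erased  : eraseB boxed ≡ erase c
    bounded : ∀ y → occB y boxed ≤ bound y

settled-≼ : ∀ {o i c} (st : BoxStatus o i c) → ¬ Pending st → c ≼ i
settled-≼ (inj₁ c≼i) _         = c≼i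
settled-≼ (inj₂ _)   ¬pending = ⊥-elim (¬pending tt)

settled-occBound : ∀ {o i c} (st : BoxStatus o i c) k → ¬ Pending st → k ≤ occBound st k
settled-occBound (inj₁ _) k _         = ≤-refl
settled-occBound (inj₂ _) k ¬pending = ⊥-elim (¬pending tt)

-- Boxing by induction on a vector xs listing the pending variables: a
-- settled variable needs nothing, and a pending variable x is moved to the
-- front of the body and bound by the door `rvar x`.
boxify : ∀ {n L A k} (xs : Vec (Fin n) k) {Eo Ei Ec : Env n} (c : ATm n) → L ∣ Ec ⊩ c ∶ A →
         (P : ∀ y → BoxStatus (Eo y) (Ei y) (Ec y)) → (∀ y → Pending (P y) → y ∈ xs) →
         (∀ y → Pending (P y) → occ y c ≤ 1) → Boxing L Eo Ei A c (λ y → occBound (P y) (occ y c))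
boxify [] c d P listed linear = record
  { boxed   = body c
  ; typed   = tbody (weaken (λ y → settled-≼ (P y) (λ p → unlisted (listed y p))) d)
  ; erased  = refl
  ; bounded = λ y → settled-occBound (P y) (occ y c) (λ p → unlisted (listed y p)) }
  where
  unlisted : ∀ {y} → ¬ y ∈ []
  unlisted ()
boxify {n} {L} {A} (x ∷ xs) {Eo} {Ei} {Ec} c d P listed linear with P x in eqx
... | inj₁ _ = boxify xs c d P listed' linear
  where
  listed' : ∀ y → Pending (P y) → y ∈ xs
  listed' y p with listed y p
  ... | here refl = ⊥-elim (transport Pending eqx p)
  ... | there y∈xs = y∈xs
... | inj₂ (B , eo , ei , ec) = record
  { boxed   = door (rvar x) (Boxing.boxed inner)
  ; typed   = tdoor door-typed front-linear (Boxing.typed inner)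
  ; erased  = trans (cong (_[ var x ]) (trans (Boxing.erased inner) (erase-renA (moveToFront x) c)))
                    (erase-moveToFront x (erase c))
  ; bounded = bounded }
  where
  P' = frontStatus x {B = B} P
  c' = renA (moveToFront x) c
  occ-c' : ∀ {y} → ¬ y ≡ x → occ (suc y) c' ≡ occ y c
  occ-c' {y} y≢x = trans (cong (λ z → occ z c') (sym (moveToFront-there y≢x)))
                         (occ-renA (moveToFront x) y (moveToFront-injectiveAt-there y≢x) c)
  listed' : ∀ y → Pending (P' y) → y ∈ Vec.map suc xs
  listed' zero    ()
  listed' (suc y) p with frontStatus-pending x P y p
  ... | y≢x , p' with listed y p'
  ...   | here y≡x   = ⊥-elim (y≢x y≡x)
  ...   | there y∈xs = ∈-map⁺ suc y∈xs
  linear' : ∀ y → Pending (P' y) → occ y c' ≤ 1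
  linear' zero    ()
  linear' (suc y) p with frontStatus-pending x P y p
  ... | y≢x , p' = ≤-trans (≤-reflexive (occ-c' y≢x)) (linear y p')
  inner : Boxing L (dnone ∷ₑ Eo) (dlin B ∷ₑ Ei) A c' (λ y → occBound (P' y) (occ y c'))
  inner = boxify (Vec.map suc xs) c' (rename-⊩ (moveToFront x) (moveToFront-≼ x Ec ec) d) P' listed' linear'
  door-typed : suc L ∣ Eo ⊩ rvar x ∶ § B
  door-typed = tvar (transport (λ s → Usable s (§ B)) (sym eo) ulin) ≥refl
  front-linear : occB zero (Boxing.boxed inner) ≤ 1
  front-linear =
    ≤-trans (Boxing.bounded inner zero)
            (≤-trans (≤-reflexive (trans (cong (λ z → occ z c') (sym (moveToFront-here x)))
                                         (occ-renA (moveToFront x) x (moveToFront-injectiveAt-here x) c)))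
                     (linear x (transport Pending (sym eqx) tt)))
  x-gone : occB (suc x) (Boxing.boxed inner) ≤ 0
  x-gone = ≤-trans (Boxing.bounded inner (suc x))
                   (≤-reflexive (trans (frontStatus-occBound-here x P _)
                                       (occ-renA-miss (moveToFront x) (suc x) (moveToFront-misses x) c)))
  bounded : ∀ y → ind y x + occB (suc y) (Boxing.boxed inner) ≤ occBound (P y) (occ y c)
  bounded y with y Fin.≟ x
  ... | yes refl = transport (λ st → ind y y + occB (suc y) (Boxing.boxed inner) ≤ occBound st (occ y c)) (sym eqx)
                             (≤-trans (+-mono-≤ (≤-reflexive (ind-refl y)) x-gone) (≤-reflexive (+-identityʳ 1)))
  ... | no y≢x   = ≤-trans (≤-reflexive (cong (_+ occB (suc y) (Boxing.boxed inner)) (ind-≢ y≢x)))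
                           (≤-trans (Boxing.bounded inner (suc y))
                                    (≤-reflexive (trans (frontStatus-occBound-there x P _ y≢x) (cong (occBound (P y)) (occ-c' y≢x)))))

parStatus : ∀ {s s'} → ParS s s' → BoxStatus (entryOf s') (hideS (entryOf s')) (entryOf s)
parStatus none = inj₁ ≼none
parStatus toΓ  = inj₁ ≼ls
parStatus toΔ  = inj₂ (_ , refl , refl , refl)

parStatus-pending : ∀ {s s'} (v : ParS s s') → Pending (parStatus v) → Σ Ty λ A → s ≡ lin A
parStatus-pending toΔ _ = _ , refl

-- The linear variables of the conclusion of (§i) are the doors.
parStatus-occBound : ∀ {s s' B} (v : ParS s s') k → s' ≡ lin B → occBound (parStatus v) k ≤ 1
parStatus-occBound toΔ k _ = ≤-refl

-- Translating DLAL_B derivations into annotated terms.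

record Translation {n} (C : Ctx n) (t : Tm n) (A : Ty) : Set where
  field
    budget : ℕ
    term   : ATm n
    typed  : budget ∣ envOf C ⊩ term ∶ A
    erased : erase term ≡ t
    linear : Linear C term
open Translation

only-here : ∀ {n} (x : Fin n) s → lookup (only x s) x ≡ s
only-here {n} x s = lookup∘update x (replicate n ∅) s

only-there : ∀ {n} {x y : Fin n} s → ¬ y ≡ x → lookup (only x s) y ≡ ∅
only-there {n} {x} {y} s y≢x = trans (lookup∘update′ y≢x (replicate n ∅) s) (lookup-replicate y ∅)

empty-lookup : ∀ {n} (x : Fin n) → lookup (empty {n}) x ≡ ∅
empty-lookup x = lookup-replicate x ∅

nl≢lin : ∀ {A B} → ¬ (nl A ≡ lin B)
nl≢lin ()

∅≢lin : ∀ {B} → ¬ (∅ ≡ lin B)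
∅≢lin ()

nl≢∅ : ∀ {A} → ¬ (nl A ≡ ∅)
nl≢∅ ()

+-≤1-zeroʳ : ∀ {a b} → b ≡ 0 → a ≤ 1 → a + b ≤ 1
+-≤1-zeroʳ {a} refl a≤1 = ≤-trans (≤-reflexive (+-identityʳ a)) a≤1

+-≤1-zeroˡ : ∀ {a b} → a ≡ 0 → b ≤ 1 → a + b ≤ 1
+-≤1-zeroˡ refl b≤1 = b≤1

Merge-linear : ∀ {n L₁ L₂} {C₁ C₂ C : Ctx n} {r₁ r₂ A₁ A₂} → Merge C₁ C₂ C →
               L₁ ∣ envOf C₁ ⊩ r₁ ∶ A₁ → L₂ ∣ envOf C₂ ⊩ r₂ ∶ A₂ → Linear C₁ r₁ → Linear C₂ r₂ →
               Linear C (appL r₁ r₂)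
Merge-linear {r₁ = r₁} {r₂} m d₁ d₂ lin₁ lin₂ y B e with Merge-lookup m y
... | inj₁ (e₁ , e₂) = +-≤1-zeroʳ (absent-occ y d₂ (cong entryOf e₂)) (lin₁ y B (trans e₁ e))
... | inj₂ (e₁ , e₂) = +-≤1-zeroˡ (absent-occ y d₁ (cong entryOf e₁)) (lin₂ y B (trans e₂ e))

translate-Id : ∀ {n} (x : Fin n) A → Translation (only x (lin A)) (var x) A
translate-Id x A = record
  { budget = 0 ; term = rvar x
  ; typed  = tvar (transport (λ s → Usable (entryOf s) A) (sym (only-here x (lin A))) ulin) ≥refl
  ; erased = refl ; linear = λ y B e → ind≤1 y x }

translate-⊸i : ∀ {n} {C : Ctx n} {t A B} → Translation (lin A ∷ C) t B → Translation C (lam t) (A ⊸ B)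
translate-⊸i T = record
  { budget = budget T ; term = lamL (term T)
  ; typed  = tlamL (linear T zero _ refl) (env-cong (λ { zero → refl ; (suc x) → refl }) (typed T))
  ; erased = cong lam (erased T) ; linear = λ y → linear T (suc y) }

translate-⇒i : ∀ {n} {C : Ctx n} {t A B} → Translation (nl A ∷ C) t B → Translation C (lam t) (A ⇒ B)
translate-⇒i T = record
  { budget = budget T ; term = lamN (term T)
  ; typed  = tlamN (env-cong (λ { zero → refl ; (suc x) → refl }) (typed T))
  ; erased = cong lam (erased T) ; linear = λ y → linear T (suc y) }

translate-⊸e : ∀ {n} {C₁ C₂ C : Ctx n} {t u A B} → Translation C₁ t (A ⊸ B) → Translation C₂ u A →
               Merge C₁ C₂ C → Translation C (app t u) B
translate-⊸e T U m = record
  { budget = budget T ⊔ budget U ; term = appL (term T) (term U)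
  ; typed  = tappL (raise-budget (m≤m⊔n _ _) (weaken (Merge-≼ˡ m) (typed T)))
                   (raise-budget (m≤n⊔m _ _) (weaken (Merge-≼ʳ m) (typed U))) ≥refl
  ; erased = cong₂ app (erased T) (erased U)
  ; linear = Merge-linear m (typed T) (typed U) (linear T) (linear U) }

-- In (⇒e) with premise ;z:A' ⊢ u : A, the variable z becomes non-linear in
-- the conclusion, so u may be typed one depth deeper, where z is shared.
translate-⇒e₁ : ∀ {n} {C C' : Ctx n} {t u A B A'} (z : Fin n) → Translation C t (A ⇒ B) →
                Translation (only z (lin A')) u A → Merge C (only z (nl A')) C' → Translation C' (app t u) B
translate-⇒e₁ {C' = C'} {A' = A'} z T U m = record
  { budget = suc (budget T ⊔ budget U) ; term = appN (term T) (term U)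
  ; typed  = tappN (raise-budget (≤-trans (m≤m⊔n _ _) (n≤1+n _)) (weaken (Merge-≼ˡ m) (typed T)))
                   (raise-budget (m≤n⊔m _ _) (weaken argument-≼ (typed U))) ≥refl
  ; erased = cong₂ app (erased T) (erased U)
  ; linear = linear-app }
  where
  C'z : lookup C' z ≡ nl A'
  C'z with Merge-lookup m z
  ... | inj₁ (_ , e) = ⊥-elim (nl≢∅ (trans (sym (only-here z (nl A'))) e))
  ... | inj₂ (_ , e) = trans (sym e) (only-here z (nl A'))
  argument-≼ : ∀ x → envOf (only z (lin A')) x ≼ hide (envOf C') x
  argument-≼ x with x Fin.≟ z
  ... | yes refl = transport (λ s → entryOf s ≼ hideS (entryOf (lookup C' x))) (sym (only-here x (lin A')))
                             (transport (λ s → dlin A' ≼ hideS (entryOf s)) (sym C'z) ≼ls)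
  ... | no x≢z   = absent-≼ _ (only-there (lin A') x≢z)
  linear-app : Linear C' (appN (term T) (term U))
  linear-app y B e with Merge-lookup m y
  ... | inj₁ (e₁ , e₂) =
    +-≤1-zeroʳ (absent-occ y (typed U) (cong entryOf (only-there (lin A') y≢z))) (linear T y B (trans e₁ e))
    where
    y≢z : ¬ y ≡ z
    y≢z refl = nl≢∅ (trans (sym (only-here y (nl A'))) e₂)
  ... | inj₂ (_ , e₂) with y Fin.≟ z
  ...   | yes refl = ⊥-elim (nl≢lin (trans (sym (only-here y (nl A'))) (trans e₂ e)))
  ...   | no y≢z   = ⊥-elim (∅≢lin (trans (sym (only-there (nl A') y≢z)) (trans e₂ e)))

translate-⇒e₀ : ∀ {n} {C : Ctx n} {t u A B} → Translation C t (A ⇒ B) → Translation empty u A → Translation C (app t u) B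
translate-⇒e₀ T U = record
  { budget = suc (budget T ⊔ budget U) ; term = appN (term T) (term U)
  ; typed  = tappN (raise-budget (≤-trans (m≤m⊔n _ _) (n≤1+n _)) (typed T))
                   (raise-budget (m≤n⊔m _ _) (weaken (λ x → absent-≼ _ (empty-lookup x)) (typed U))) ≥refl
  ; erased = cong₂ app (erased T) (erased U)
  ; linear = λ y B e → +-≤1-zeroʳ (absent-occ y (typed U) (cong entryOf (empty-lookup y))) (linear T y B e) }

translate-Weak : ∀ {n} {C C' : Ctx n} {t A} → Translation C t A → Sub C C' → Translation C' t A
translate-Weak {C = C} {C'} T s = record
  { budget = budget T ; term = term T ; typed = weaken extend (typed T) ; erased = erased T ; linear = linear' }
  where
  extend : ∀ x → envOf C x ≼ envOf C' x
  extend x with Sub-lookup s x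
  ... | inj₁ e = absent-≼ _ e
  ... | inj₂ e = ≡⇒≼ (cong entryOf e)
  linear' : Linear C' (term T)
  linear' y B e with Sub-lookup s y
  ... | inj₁ e' = ≤-trans (≤-reflexive (absent-occ y (typed T) (cong entryOf e'))) z≤n
  ... | inj₂ e' = linear T y B (trans e' e)

merge-var-here : ∀ {n} (j i : Fin n) → merge-var j i j ≡ i
merge-var-here j i = cong (λ b → if b then i else j) (dec-true (j Fin.≟ j) refl)

merge-var-there : ∀ {n} {j i k : Fin n} → ¬ k ≡ j → merge-var j i k ≡ k
merge-var-there {j = j} {i} {k} k≢j = cong (λ b → if b then i else k) (dec-false (k Fin.≟ j) k≢j)

-- Contraction identifies x₂ with x₁; both are non-linear, so linear
-- variables are renamed injectively.
translate-Cntr : ∀ {n} {C : Ctx n} {t A B} (x₁ x₂ : Fin n) → ¬ x₁ ≡ x₂ →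
                 lookup C x₁ ≡ nl A → lookup C x₂ ≡ nl A →
                 Translation C t B → Translation (C [ x₂ ]≔ ∅) (rename (merge-var x₂ x₁) t) B
translate-Cntr {C = C} x₁ x₂ x₁≢x₂ e₁ e₂ T = record
  { budget = budget T ; term = renA ρ (term T)
  ; typed  = rename-⊩ ρ respects (typed T)
  ; erased = trans (erase-renA ρ (term T)) (cong (rename ρ) (erased T))
  ; linear = linear' }
  where
  ρ = merge-var x₂ x₁
  C' = C [ x₂ ]≔ ∅
  respects : ∀ y → envOf C y ≼ envOf C' (ρ y)
  respects y = by-cases (y Fin.≟ x₂)
    where
    by-cases : Dec (y ≡ x₂) → envOf C y ≼ envOf C' (ρ y)
    by-cases (yes refl) = transport (λ z → envOf C y ≼ envOf C' z) (sym (merge-var-here y x₁))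
                                    (≡⇒≼ (cong entryOf (trans e₂ (trans (sym e₁) (sym (lookup∘update′ x₁≢x₂ C ∅))))))
    by-cases (no y≢x₂)  = transport (λ z → envOf C y ≼ envOf C' z) (sym (merge-var-there y≢x₂))
                                    (≡⇒≼ (cong entryOf (sym (lookup∘update′ y≢x₂ C ∅))))
  linear' : Linear C' (renA ρ (term T))
  linear' y B e with y Fin.≟ x₂ | y Fin.≟ x₁
  ... | yes refl | _        = ⊥-elim (∅≢lin (trans (sym (lookup∘update y C ∅)) e))
  ... | no y≢x₂  | yes refl = ⊥-elim (nl≢lin (trans (sym e₁) (trans (sym (lookup∘update′ y≢x₂ C ∅)) e)))
  ... | no y≢x₂  | no y≢x₁  =
    ≤-trans (≤-reflexive (trans (cong (λ w → occ w (renA ρ (term T))) (sym (merge-var-there y≢x₂)))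
                                (occ-renA ρ y injective (term T))))
            (linear T y B (trans (sym (lookup∘update′ y≢x₂ C ∅)) e))
    where
    injective : InjectiveAt ρ y
    injective w ρw≡ρy = by-cases (w Fin.≟ x₂)
      where
      by-cases : Dec (w ≡ x₂) → w ≡ y
      by-cases (yes refl) = ⊥-elim (y≢x₁ (sym (trans (sym (merge-var-here w x₁)) (trans ρw≡ρy (merge-var-there y≢x₂)))))
      by-cases (no w≢x₂)  = trans (sym (merge-var-there w≢x₂)) (trans ρw≡ρy (merge-var-there y≢x₂))

-- (§i) boxes the translated body; the Δ-variables become doors.
translate-§i : ∀ {n} {C C' : Ctx n} {t A} → Translation C t A → Par C C' → Translation C' t (§ A)
translate-§i {n} {C} {C'} T p = record
  { budget = suc (budget T) ; term = box (Boxing.boxed boxing)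
  ; typed  = tbox (Boxing.typed boxing)
  ; erased = trans (Boxing.erased boxing) (erased T)
  ; linear = λ y B e → ≤-trans (Boxing.bounded boxing y) (parStatus-occBound (Par-lookup p y) (occ y (term T)) e) }
  where
  status : ∀ y → BoxStatus (envOf C' y) (hide (envOf C') y) (envOf C y)
  status y = parStatus (Par-lookup p y)
  pending-linear : ∀ y → Pending (status y) → occ y (term T) ≤ 1
  pending-linear y pending with parStatus-pending (Par-lookup p y) pending
  ... | B , e = linear T y B e
  boxing = boxify (allFin n) (term T) (typed T) status (λ y _ → ∈-allFin⁺ y) pending-linear

translate-§e : ∀ {n} {C₁ C₂ C : Ctx n} {u t A B} → Translation C₁ u (§ A) → Translation (lin (§ A) ∷ C₂) t B →
               Merge C₁ C₂ C → Translation C (t [ u ]) B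
translate-§e {C = C} {A = A} U T m = record
  { budget = budget U ⊔ budget T ; term = term T [ term U ]ᴬ
  ; typed  = subst-⊩ (singleA-SubstOK (dlin _) (λ { ulin → raise-budget (m≤m⊔n _ _) (weaken (Merge-≼ˡ m) (typed U)) }) (λ ()))
                     (raise-budget (m≤n⊔m _ _) (weaken (λ { zero → ≼refl ; (suc x) → Merge-≼ʳ m x }) (typed T)))
  ; erased = trans (erase-[]ᴬ (term T) (term U)) (cong₂ _[_] (erased T) (erased U))
  ; linear = linear' }
  where
  linear' : Linear C (term T [ term U ]ᴬ)
  linear' y B e with Merge-lookup m y
  ... | inj₁ (e₁ , e₂) =
    ≤-trans (occ-[]ᴬ (term T) (term U) y)
            (≤-trans (≤-reflexive (trans (cong (occ zero (term T) * occ y (term U) +_)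
                                               (absent-occ (suc y) (typed T) (cong entryOf e₂)))
                                         (+-identityʳ _)))
                     (*-mono-≤ (linear T zero (§ A) refl) (linear U y B (trans e₁ e))))
  ... | inj₂ (e₁ , e₂) =
    ≤-trans (occ-[]ᴬ (term T) (term U) y)
            (≤-trans (≤-reflexive (cong (_+ occ (suc y) (term T))
                                        (trans (cong (occ zero (term T) *_) (absent-occ y (typed U) (cong entryOf e₁)))
                                               (*-zeroʳ (occ zero (term T))))))
                     (linear T (suc y) B (trans e₂ e)))

entryOf-shiftSlot : ∀ B s → substEntry 0 B (entryOf (shiftSlot s)) ≡ entryOf s
entryOf-shiftSlot B ∅       = refl
entryOf-shiftSlot B (lin A) = cong dlin (substTy-shiftTy 0 B A)
entryOf-shiftSlot B (nl A)  = cong dnl (substTy-shiftTy 0 B A)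

translate-∀i : ∀ {n} {C : Ctx n} {t A} → Translation (map shiftSlot C) t A → Translation C t (⋀ A)
translate-∀i {C = C} T = record
  { budget = budget T ; term = term T
  ; typed  = t∀ (λ B → env-cong (unshift B) (substTy-⊩ 0 B (typed T)))
  ; erased = erased T
  ; linear = λ y A' e → linear T y (shiftTy 0 A') (trans (lookup-map y shiftSlot C) (cong shiftSlot e)) }
  where
  unshift : ∀ B x → substEntry 0 B (envOf (map shiftSlot C) x) ≡ envOf C x
  unshift B x = trans (cong (λ s → substEntry 0 B (entryOf s)) (lookup-map x shiftSlot C)) (entryOf-shiftSlot B (lookup C x))

translate-∀e : ∀ {n} {C : Ctx n} {t A} B → Translation C t (⋀ A) → Translation C t (A [ B ]ᵀ)
translate-∀e B T = record
  { budget = budget T ; term = term T ; typed = ∀-elim B (typed T) ; erased = erased T ; linear = linear T }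

-- (Be): the branches share the context, so linearity holds by maximum.
translate-Be : ∀ {n} {C : Ctx n} {M₀ M₁ M₂ A} k → Translation C M₀ (§^ k 𝔹) →
               Translation C M₁ A → Translation C M₂ A →
               Translation C (ite M₀ M₁ M₂) A
translate-Be k T₀ T₁ T₂ = record
  { budget = budget T₀ ⊔ (budget T₁ ⊔ budget T₂) ; term = rite (term T₀) (term T₁) (term T₂)
  ; typed  = tite k (raise-budget (m≤m⊔n _ _) (typed T₀))
                    (raise-budget (≤-trans (m≤m⊔n _ _) (m≤n⊔m (budget T₀) _)) (typed T₁))
                    (raise-budget (≤-trans (m≤n⊔m (budget T₁) _) (m≤n⊔m (budget T₀) _)) (typed T₂))
  ; erased = cong₃ ite (erased T₀) (erased T₁) (erased T₂)
  ; linear = λ y B e → ⊔-lub (linear T₀ y B e) (⊔-lub (linear T₁ y B e) (linear T₂ y B e)) }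

translate : ∀ {n} {C : Ctx n} {t A} → C ⊢ t ∶ A → Translation C t A
translate (Id {x} {A})                   = translate-Id x A
translate (⊸i d)                         = translate-⊸i (translate d)
translate (⊸e d₁ d₂ m)                   = translate-⊸e (translate d₁) (translate d₂) m
translate (⇒i d)                         = translate-⇒i (translate d)
translate (⇒e₁ {z = z} d₁ d₂ m)          = translate-⇒e₁ z (translate d₁) (translate d₂) m
translate (⇒e₀ d₁ d₂)                    = translate-⇒e₀ (translate d₁) (translate d₂)
translate (Weak d s)                     = translate-Weak (translate d) s
translate (Cntr x₁ x₂ x₁≢x₂ e₁ e₂ d)     = translate-Cntr x₁ x₂ x₁≢x₂ e₁ e₂ (translate d)
translate (§i d p)                       = translate-§i (translate d) p
translate (§e d₁ d₂ m)                   = translate-§e (translate d₁) (translate d₂) m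
translate (∀i d)                         = translate-∀i (translate d)
translate (∀e B d)                       = translate-∀e B (translate d)
translate B₀i                            = record { budget = 0 ; term = rF ; typed = tF ; erased = refl ; linear = λ _ _ _ → z≤n }
translate B₁i                            = record { budget = 0 ; term = rT ; typed = tT ; erased = refl ; linear = λ _ _ _ → z≤n }
translate (Be k d₀ d₁ d₂)                = translate-Be k (translate d₀) (translate d₁) (translate d₂)

typable-normalising : ∀ {n} {C : Ctx n} {t A} → C ⊢ t ∶ A → Σ (Tm n) λ u → (t ⟶* u) × Normal u
typable-normalising d with translate d
... | T with annotated-normalising (term T) (typed T)
...   | u , t⟶*u , nu = u , transport (_⟶* u) (erased T) t⟶*u , nu

theorem4 : ∀ {n : ℕ} {C : Ctx n} {t : Tm n} {A : Ty} →
    C ⊢ t ∶ A → ∃! _≡_ (λ u → (t ⟶* u) × Normal u)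
theorem4 d with typable-normalising d
... | u , t⟶*u , nu = u , (t⟶*u , nu) , λ (t⟶*v , nv) → unique-normal-form t⟶*u nu t⟶*v nv
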